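{- Let $r\ge1$, let $\mathbf{k}=(k_1,\ldots,k_r)$ be a sequence of positive integers and let $1\le i\le r$. Then in $\mathcal{A}$ $$\zeta^{(i)}_{\mathcal{A}}(\mathbf{k})=\sum_{\phi\in\Phi^i_r}\zeta_{\mathcal{A}}\Big(\sum_{j:\phi(j)=1}k_j,\ \ldots,\ \sum_{j:\phi(j)=s_\phi}k_j\Big),$$ where for $\phi\in\Phi_r$, $s_\phi$ denotes the $s$ with $\phi\in\Phi_{r,s}$.
   Context: $\mathcal{A}:=\big(\prod_{p \text{ prime}}\mathbb{F}_p\big)/\big(\bigoplus_{p\text{ prime}}\mathbb{F}_p\big)$; an element is represented by a family $(a_p)_p$, $a_p\in\mathbb{F}_p$, two families being equal iff they agree for all but finitely many primes $p$. For positive integers $l_1,\ldots,l_r$ write $L_j=l_1+\cdots+l_j$. The finite multiple zeta value is $\zeta_{\mathcal{A}}(k_1,\ldots,k_r):=\Big(\sum_{l_1,\ldots,l_r\ge1,\ L_r<p}\frac{1}{L_1^{k_1}\cdots L_r^{k_r}}\bmod p\Big)_p\in\mathcal{A}$ (and $\zeta_{\mathcal A}$ of the empty sequence is $1$). The variant is $$\zeta^{(i)}_{\mathcal{A}}(k_1,\ldots,k_r):=\Big({\sum_{\substack{0<l_1,\ldots,l_r<p\\ (i-1)p<L_r<ip}}}'\frac{1}{L_1^{k_1}\cdots L_r^{k_r}}\Big)_p,$$ where $\sum'$ means the sum is taken only over those tuples for which all of $L_1,\ldots,L_r$ are prime to $p$, and each term is read in $\mathbb{F}_p$. For $1\le s\le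 r$, $\Phi_{r,s}$ is the set of surjections $\phi:\{1,\ldots,r\}\to\{1,\ldots,s\}$ with $\phi(a)\ne\phi(a+1)$ for all $1\le a\le r-1$, and $\Phi_r:=\bigsqcup_{s=1}^r\Phi_{r,s}$. For $\phi\in\Phi_r$ and $1\le m\le r$ put $\delta_\phi(m):=\#\{a\in\{1,\ldots,m-1\}\mid \phi(a)>\phi(a+1)\}$, and $\Phi^i_r:=\{\phi\in\Phi_r\mid \delta_\phi(r)+1=i\}$. -}

module Defs where

open import Data.Nat using (ℕ; zero; suc; _+_; _*_; _∸_; _^_; _%_; _<ᵇ_; _≡ᵇ_)
open import Data.Bool using (Bool; true; false; not; _∧_)
open import Data.List using (List; []; _∷_; map; concatMap; filterᵇ; zip; zipWith; upTo)
open import Data.Nat.ListAction using (sum; product)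
open import Data.Bool.ListAction using (all; any)
open import Data.Product using (_×_; _,_; proj₁; proj₂)

-- reduction modulo p (p is always a prime, hence nonzero, where used)
modP : ℕ → ℕ → ℕ
modP zero    x = x
modP (suc q) x = x % suc q

-- inverse of x in F_p, for p prime and p ∤ x (Fermat: x^(p-2))
invP : ℕ → ℕ → ℕ
invP p x = modP p (x ^ (p ∸ 2))

range1 : ℕ → List ℕ
range1 n = map suc (upTo n)

lists : ℕ → List ℕ → List (List ℕ)
lists zero    xs = [] ∷ []
lists (suc r) xs = concatMap (λ x → map (x ∷_) (lists r xs)) xs

psums : ℕ → List ℕ → List ℕ
psums acc []       = []
psums acc (x ∷ xs) = (acc + x) ∷ psums (acc + x) xs

partialSums : List ℕ → List ℕ
partialSums = psums 0

-- the term  1 / (L_1^{k_1} ... L_r^{k_r})  in F_p (as a natural number, not yet reduced)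
term : ℕ → List ℕ → List ℕ → ℕ
term p ks ls = product (zipWith (λ L k → invP p L ^ k) (partialSums ls) ks)

tuples : ℕ → List ℕ → List (List ℕ)
tuples p ks = lists (Data.List.length ks) (range1 (p ∸ 1))

-- p-component of ζ_A(k): sum over l_j ≥ 1 with L_r < p  (such l_j automatically < p)
zetaA : ℕ → List ℕ → ℕ
zetaA p ks = modP p (sum (map (term p ks)
  (filterᵇ (λ ls → sum ls <ᵇ p) (tuples p ks))))

-- p-component of ζ^{(i)}_A(k): sum over 0 < l_j < p, (i-1)p < L_r < ip,
-- all L_j prime to p
zetaAi : ℕ → ℕ → List ℕ → ℕ
zetaAi p i ks = modP p (sum (map (term p ks)
  (filterᵇ (λ ls → ((i ∸ 1) * p <ᵇ sum ls) ∧ (sum ls <ᵇ i * p)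
                   ∧ all (λ L → not (modP p L ≡ᵇ 0)) (partialSums ls))
           (tuples p ks))))

-- φ : {1..r} → {1..s} encoded as the list (φ(1), ..., φ(r))
adjDistinct : List ℕ → Bool
adjDistinct (x ∷ y ∷ xs) = not (x ≡ᵇ y) ∧ adjDistinct (y ∷ xs)
adjDistinct _            = true

surjOnto : ℕ → List ℕ → Bool
surjOnto s φ = all (λ t → any (t ≡ᵇ_) φ) (range1 s)

descents : List ℕ → ℕ
descents (x ∷ y ∷ xs) = (if y <ᵇ x then 1 else 0) + descents (y ∷ xs)
  where open import Data.Bool using (if_then_else_)
descents _            = 0

Phi : ℕ → ℕ → List (List ℕ)
Phi r s = filterᵇ (λ φ → surjOnto s φ ∧ adjDistinct φ) (lists r (range1 s))

-- Φ^i_r as pairs (s_φ, φ)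
PhiI : ℕ → ℕ → List (ℕ × List ℕ)
PhiI r i = filterᵇ (λ sφ → (descents (proj₂ sφ) + 1) ≡ᵇ i)
  (concatMap (λ s → map (s ,_) (Phi r s)) (range1 r))

merge : List ℕ → ℕ → List ℕ → List ℕ
merge ks s φ = map (λ t → sum (map proj₁ (filterᵇ (λ kf → proj₂ kf ≡ᵇ t) (zip ks φ))))
                   (range1 s)

-- p-component of the right-hand side
rhsP : ℕ → ℕ → List ℕ → ℕ
rhsP p i ks = modP p (sum (map (λ sφ → zetaA p (merge ks (proj₁ sφ) (proj₂ sφ)))
                               (PhiI (Data.List.length ks) i)))

module Submission where

-- We prove the p-components equal for every modulus p = 1 + n by two
-- changes of variables that meet in a common middle set: the residue words M ∈ [1, p - 1]^r
-- with no two equal neighbours and exactly i - 1 descents.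
--  * Left side: a tuple of steps l_j ∈ [1, p) is sent to the residues L_j mod p of its partial
--    sums.  Consecutive residues differ, each descent is one wrap-around past a multiple of p,
--    so the total lies in ((i-1)p, ip) iff there are i - 1 descents (module Residues).  The
--    summand only depends on these residues.
--  * Right side: a triple (s, φ, ls) with φ ∈ Φ^i_{r,s} and steps ls of total below p is sent
--    to the word (m_{φ(1)}, ..., m_{φ(r)}) built from the ascending partial sums m of ls; its
--    inverse takes the distinct letters of a word and its pattern of ranks (Compression).
--    Regrouping ∏_j m_{φ(j)}^{-k_j} = ∏_t m_t^{-K_t} turns the summand into that of ζ_A.
-- Both are instances of a change-of-variables lemma for sums over enumerated finite sets
-- (sum-bijection), developed first together with the summation toolkit.

open import Defs
open import Data.Nat using (ℕ; _≤_; _<_)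
open import Data.Nat.Primality using (Prime)
open import Data.List using (List; length)
open import Data.List.Relation.Unary.All using (All)
open import Data.Product using (∃-syntax)
open import Relation.Binary.PropositionalEquality using (_≡_)

open import Data.Nat using (zero; suc; _+_; _*_; _∸_; _^_; _%_; _/_; _<ᵇ_; _≡ᵇ_; z≤n; s≤s; _<?_; _≟_)
open import Data.Nat.Properties
open import Data.Nat.DivMod
open import Data.Nat.ListAction using (sum; product)
open import Data.Nat.ListAction.Properties using (sum-++)
open import Data.Bool using (Bool; true; false; not; _∧_; _∨_; if_then_else_; T)
open import Data.Bool.ListAction using (all; any)
open import Data.List using ([]; _∷_; _++_; map; concatMap; filterᵇ; zip; zipWith; foldr; applyUpTo)
open import Data.List.Relation.Unary.All using ([]; _∷_)
import Data.List.Relation.Unary.All as All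
import Data.List.Relation.Unary.All.Properties as AllP
import Data.List.Properties as ListP
import Data.Bool.Properties as BoolP
open import Data.Empty using (⊥-elim)
open import Data.Unit using (⊤; tt)
open import Data.Sum using (_⊎_; inj₁; inj₂)
open import Data.Product using (_×_; _,_; proj₁; proj₂; Σ-syntax)
open import Relation.Binary.PropositionalEquality using (_≢_; refl; sym; trans; cong; cong₂; subst; subst₂; module ≡-Reasoning)
open import Relation.Binary.Definitions using (tri<; tri≈; tri>)
open import Relation.Nullary using (yes; no; ¬_)
open import Relation.Nullary.Decidable using (T?)
open import Function using (_∘_)

≡ᵇ-sound : ∀ m n → (m ≡ᵇ n) ≡ true → m ≡ n
≡ᵇ-sound m n e = ≡ᵇ⇒≡ m n (subst T (sym e) _)

≡ᵇ-refl : ∀ m → (m ≡ᵇ m) ≡ true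
≡ᵇ-refl zero    = refl
≡ᵇ-refl (suc m) = ≡ᵇ-refl m

≡ᵇ-false : ∀ m n → m ≢ n → (m ≡ᵇ n) ≡ false
≡ᵇ-false m n m≢n with m ≡ᵇ n in e
... | true  = ⊥-elim (m≢n (≡ᵇ-sound m n e))
... | false = refl

≡ᵇ-sym : ∀ m n → (m ≡ᵇ n) ≡ (n ≡ᵇ m)
≡ᵇ-sym zero    zero    = refl
≡ᵇ-sym zero    (suc n) = refl
≡ᵇ-sym (suc m) zero    = refl
≡ᵇ-sym (suc m) (suc n) = ≡ᵇ-sym m n

<ᵇ-sound : ∀ m n → (m <ᵇ n) ≡ true → m < n
<ᵇ-sound m n e = <ᵇ⇒< m n (subst T (sym e) _)

<ᵇ-true : ∀ {m n} → m < n → (m <ᵇ n) ≡ true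
<ᵇ-true {m} {n} m<n with m <ᵇ n in e
... | true  = refl
... | false = ⊥-elim (subst T e (<⇒<ᵇ m<n))

<ᵇ-false : ∀ {m n} → ¬ m < n → (m <ᵇ n) ≡ false
<ᵇ-false {m} {n} m≮n with m <ᵇ n in e
... | true  = ⊥-elim (m≮n (<ᵇ-sound m n e))
... | false = refl

<ᵇ-false⇒≥ : ∀ {m n} → (m <ᵇ n) ≡ false → n ≤ m
<ᵇ-false⇒≥ {m} {n} e = ≮⇒≥ (λ m<n → subst T e (<⇒<ᵇ m<n))

∧-true-l : ∀ {a b} → (a ∧ b) ≡ true → a ≡ true
∧-true-l {true} _ = refl

∧-true-r : ∀ {a b} → (a ∧ b) ≡ true → b ≡ true
∧-true-r {true} e = e

∧-true : ∀ {a b} → a ≡ true → b ≡ true → (a ∧ b) ≡ true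
∧-true refl refl = refl

false≢true : false ≢ true
false≢true ()

bool-ext : ∀ a b → (a ≡ true → b ≡ true) → (b ≡ true → a ≡ true) → a ≡ b
bool-ext true  b     a⇒b _   = sym (a⇒b refl)
bool-ext false true  _   b⇒a = b⇒a refl
bool-ext false false _   _   = refl

if-∧ : ∀ a b (v : ℕ) → (if a ∧ b then v else 0) ≡ (if a then (if b then v else 0) else 0)
if-∧ true  b v = refl
if-∧ false b v = refl

ind : Bool → ℕ
ind b = if b then 1 else 0

∑ : {A : Set} → List A → (A → ℕ) → ℕ
∑ xs f = sum (map f xs)

∑-cong : {A : Set} (xs : List A) {f g : A → ℕ} → (∀ x → f x ≡ g x) → ∑ xs f ≡ ∑ xs g
∑-cong []       e = refl
∑-cong (x ∷ xs) e = cong₂ _+_ (e x) (∑-cong xs e)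

∑-cong-All : {A : Set} {P : A → Set} (xs : List A) {f g : A → ℕ} → All P xs →
  (∀ x → P x → f x ≡ g x) → ∑ xs f ≡ ∑ xs g
∑-cong-All []       []         e = refl
∑-cong-All (x ∷ xs) (px ∷ pxs) e = cong₂ _+_ (e x px) (∑-cong-All xs pxs e)

∑-map : {A B : Set} (xs : List A) (g : A → B) (f : B → ℕ) → ∑ (map g xs) f ≡ ∑ xs (λ x → f (g x))
∑-map []       g f = refl
∑-map (x ∷ xs) g f = cong (f (g x) +_) (∑-map xs g f)

∑-concatMap : {A B : Set} (xs : List A) (g : A → List B) (f : B → ℕ) →
  ∑ (concatMap g xs) f ≡ ∑ xs (λ x → ∑ (g x) f)
∑-concatMap []       g f = refl
∑-concatMap (x ∷ xs) g f = begin
  sum (map f (g x ++ concatMap g xs))        ≡⟨ cong sum (ListP.map-++ f (g x) (concatMap g xs)) ⟩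
  sum (map f (g x) ++ map f (concatMap g xs)) ≡⟨ sum-++ (map f (g x)) (map f (concatMap g xs)) ⟩
  ∑ (g x) f + ∑ (concatMap g xs) f           ≡⟨ cong (∑ (g x) f +_) (∑-concatMap xs g f) ⟩
  ∑ (g x) f + ∑ xs (λ y → ∑ (g y) f)         ∎
  where open ≡-Reasoning

∑-filter : {A : Set} (xs : List A) (P : A → Bool) (f : A → ℕ) →
  ∑ (filterᵇ P xs) f ≡ ∑ xs (λ x → if P x then f x else 0)
∑-filter []       P f = refl
∑-filter (x ∷ xs) P f with P x
... | true  = cong (f x +_) (∑-filter xs P f)
... | false = ∑-filter xs P f

∑-zero : {A : Set} (xs : List A) → ∑ xs (λ _ → 0) ≡ 0
∑-zero []       = refl
∑-zero (x ∷ xs) = ∑-zero xs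

∑-if : {A : Set} (xs : List A) (b : Bool) (f : A → ℕ) →
  ∑ xs (λ x → if b then f x else 0) ≡ (if b then ∑ xs f else 0)
∑-if xs true  f = refl
∑-if xs false f = ∑-zero xs

∑-+ : {A : Set} (xs : List A) (f g : A → ℕ) → ∑ xs (λ x → f x + g x) ≡ ∑ xs f + ∑ xs g
∑-+ []       f g = refl
∑-+ (x ∷ xs) f g = begin
  f x + g x + ∑ xs (λ y → f y + g y) ≡⟨ cong (f x + g x +_) (∑-+ xs f g) ⟩
  f x + g x + (∑ xs f + ∑ xs g)      ≡⟨ +-assoc (f x) (g x) _ ⟩
  f x + (g x + (∑ xs f + ∑ xs g))    ≡⟨ cong (f x +_) (+-comm (g x) _) ⟩
  f x + ((∑ xs f + ∑ xs g) + g x)    ≡⟨ cong (f x +_) (+-assoc (∑ xs f) (∑ xs g) (g x)) ⟩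
  f x + (∑ xs f + (∑ xs g + g x))    ≡⟨ sym (+-assoc (f x) (∑ xs f) _) ⟩
  f x + ∑ xs f + (∑ xs g + g x)      ≡⟨ cong (f x + ∑ xs f +_) (+-comm (∑ xs g) (g x)) ⟩
  f x + ∑ xs f + (g x + ∑ xs g)      ∎
  where open ≡-Reasoning

∑-swap : {A B : Set} (xs : List A) (ys : List B) (h : A → B → ℕ) →
  ∑ xs (λ a → ∑ ys (λ b → h a b)) ≡ ∑ ys (λ b → ∑ xs (λ a → h a b))
∑-swap []       ys h = sym (∑-zero ys)
∑-swap (x ∷ xs) ys h = trans (cong (∑ ys (h x) +_) (∑-swap xs ys h))
  (sym (∑-+ ys (h x) (λ b → ∑ xs (λ a → h a b))))

fromTo : ℕ → ℕ → List ℕ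
fromTo a zero    = []
fromTo a (suc k) = a ∷ fromTo (suc a) k

inInterval : ℕ → ℕ → ℕ → Bool
inInterval a k y = not (y <ᵇ a) ∧ (y <ᵇ a + k)

inInterval-sound : ∀ a k y → inInterval a k y ≡ true → a ≤ y × y < a + k
inInterval-sound a k y e with y <ᵇ a in e₁
... | false = <ᵇ-false⇒≥ e₁ , <ᵇ-sound y (a + k) e

inInterval-true : ∀ {a k y} → a ≤ y → y < a + k → inInterval a k y ≡ true
inInterval-true {a} {k} {y} a≤y y<a+k rewrite <ᵇ-false {y} {a} (λ y<a → <⇒≱ y<a a≤y) | <ᵇ-true y<a+k = refl

inInterval-empty : ∀ a y → inInterval a 0 y ≡ false
inInterval-empty a y with y <ᵇ a in e
... | true  = refl
... | false rewrite +-identityʳ a | e = refl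

inInterval-self : ∀ a k → inInterval a (suc k) a ≡ true
inInterval-self a k = inInterval-true ≤-refl (m<m+n a (s≤s z≤n))

inInterval-self-suc : ∀ a k → inInterval (suc a) k a ≡ false
inInterval-self-suc a k rewrite <ᵇ-true (n<1+n a) = refl

inInterval-suc : ∀ a k y → a ≢ y → inInterval (suc a) k y ≡ inInterval a (suc k) y
inInterval-suc a k y a≢y rewrite +-suc a k with <-cmp y a
... | tri< y<a _ _ rewrite <ᵇ-true y<a | <ᵇ-true (m<n⇒m<1+n y<a) = refl
... | tri≈ _ y≡a _ = ⊥-elim (a≢y (sym y≡a))
... | tri> _ _ a<y rewrite <ᵇ-false {y} {a} (<⇒≯ a<y) | <ᵇ-false {y} {suc a} (λ y<1+a → <⇒≱ a<y (≤-pred y<1+a)) = refl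

fromTo-inInterval : ∀ k a → All (λ y → inInterval a k y ≡ true) (fromTo a k)
fromTo-inInterval zero    a = []
fromTo-inInterval (suc k) a = inInterval-self a k ∷ All.map shift (fromTo-inInterval k (suc a))
  where
  shift : ∀ {y} → inInterval (suc a) k y ≡ true → inInterval a (suc k) y ≡ true
  shift {y} h = trans (sym (inInterval-suc a k y (λ a≡y → <-irrefl a≡y (proj₁ (inInterval-sound (suc a) k y h))))) h

range1≡fromTo : ∀ n → range1 n ≡ fromTo 1 n
range1≡fromTo n = trans (ListP.map-upTo suc n) (shifted n 1 suc (λ _ → refl))
  where
  shifted : ∀ n a (f : ℕ → ℕ) → (∀ x → f x ≡ a + x) → applyUpTo f n ≡ fromTo a n
  shifted zero    a f e = refl
  shifted (suc n) a f e = cong₂ _∷_ (trans (e 0) (+-identityʳ a))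
    (shifted n (suc a) (λ x → f (suc x)) (λ x → trans (e (suc x)) (+-suc a x)))

module _ (_⊕_ : ℕ → ℕ → ℕ) (e : ℕ) (identityˡ : ∀ x → e ⊕ x ≡ x) (identityʳ : ∀ x → x ⊕ e ≡ x) where

  foldr-delta : ∀ k a y (c : ℕ → ℕ) →
    foldr _⊕_ e (map (λ x → if x ≡ᵇ y then c x else e) (fromTo a k)) ≡ (if inInterval a k y then c y else e)
  foldr-delta zero    a y c rewrite inInterval-empty a y = refl
  foldr-delta (suc k) a y c with a ≟ y
  ... | yes refl rewrite ≡ᵇ-refl a | foldr-delta k (suc a) a c | inInterval-self-suc a k | inInterval-self a k = identityʳ (c a)
  ... | no a≢y   rewrite ≡ᵇ-false a y a≢y | foldr-delta k (suc a) y c | inInterval-suc a k y a≢y = identityˡ _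

-- An enumeration of a finite set: a list of elements, a validity test, and a boolean
-- equality such that every valid element occurs exactly once (sum-delta: summing a
-- Kronecker delta at y over the list yields the value at y iff y is valid).
record Enumeration (A : Set) : Set₁ where
  field
    elems       : List A
    valid       : A → Bool
    eqᵇ         : A → A → Bool
    eqᵇ-sound   : ∀ a b → eqᵇ a b ≡ true → a ≡ b
    eqᵇ-refl    : ∀ a → eqᵇ a a ≡ true
    elems-valid : All (λ a → valid a ≡ true) elems
    sum-delta   : ∀ y (c : A → ℕ) → ∑ elems (λ a → if eqᵇ a y then c a else 0) ≡ (if valid y then c y else 0)

open Enumeration

sum-bijection : {A B : Set} (EA : Enumeration A) (EB : Enumeration B)
  (P : A → Bool) (Q : B → Bool) (F : A → B) (G : B → A) (f : A → ℕ) (g : B → ℕ) →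
  (∀ a → valid EA a ≡ true → P a ≡ true →
     valid EB (F a) ≡ true × Q (F a) ≡ true × G (F a) ≡ a × f a ≡ g (F a)) →
  (∀ b → valid EB b ≡ true → Q b ≡ true →
     valid EA (G b) ≡ true × P (G b) ≡ true × F (G b) ≡ b) →
  ∑ (elems EA) (λ a → if P a then f a else 0) ≡ ∑ (elems EB) (λ b → if Q b then g b else 0)
sum-bijection {A} {B} EA EB P Q F G f g forward backward = begin
  ∑ (elems EA) (λ a → if P a then f a else 0)
    ≡⟨ ∑-cong-All (elems EA) (elems-valid EA) expand ⟩
  ∑ (elems EA) (λ a → ∑ (elems EB) (λ b → if graphF a b then g b else 0))
    ≡⟨ ∑-swap (elems EA) (elems EB) _ ⟩
  ∑ (elems EB) (λ b → ∑ (elems EA) (λ a → if graphF a b then g b else 0))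
    ≡⟨ ∑-cong-All (elems EB) (elems-valid EB) (λ b vb →
         ∑-cong-All (elems EA) (elems-valid EA) (λ a va → cong (λ c → if c then g b else 0) (graph-sym a b va vb))) ⟩
  ∑ (elems EB) (λ b → ∑ (elems EA) (λ a → if graphG a b then g b else 0))
    ≡⟨ ∑-cong-All (elems EB) (elems-valid EB) collapse ⟩
  ∑ (elems EB) (λ b → if Q b then g b else 0) ∎
  where
  open ≡-Reasoning

  graphF : A → B → Bool
  graphF a b = eqᵇ EB b (F a) ∧ P a
  graphG : A → B → Bool
  graphG a b = eqᵇ EA a (G b) ∧ Q b

  graph-sym : ∀ a b → valid EA a ≡ true → valid EB b ≡ true → graphF a b ≡ graphG a b
  graph-sym a b va vb = bool-ext _ _ to from
    where
    to : graphF a b ≡ true → graphG a b ≡ true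
    to h with eqᵇ-sound EB b (F a) (∧-true-l h)
    ... | refl with forward a va (∧-true-r {eqᵇ EB (F a) (F a)} h)
    ...   | _ , qFa , GFa≡a , _ = ∧-true (subst (λ x → eqᵇ EA a x ≡ true) (sym GFa≡a) (eqᵇ-refl EA a)) qFa
    from : graphG a b ≡ true → graphF a b ≡ true
    from h with eqᵇ-sound EA a (G b) (∧-true-l h)
    ... | refl with backward b vb (∧-true-r {eqᵇ EA (G b) (G b)} h)
    ...   | _ , pGb , FGb≡b = ∧-true (subst (λ x → eqᵇ EB b x ≡ true) (sym FGb≡b) (eqᵇ-refl EB b)) pGb

  expand : ∀ a → valid EA a ≡ true →
    (if P a then f a else 0) ≡ ∑ (elems EB) (λ b → if graphF a b then g b else 0)
  expand a va = sym (begin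
    ∑ (elems EB) (λ b → if graphF a b then g b else 0)
      ≡⟨ ∑-cong (elems EB) (λ b → if-∧ (eqᵇ EB b (F a)) (P a) (g b)) ⟩
    ∑ (elems EB) (λ b → if eqᵇ EB b (F a) then (if P a then g b else 0) else 0)
      ≡⟨ sum-delta EB (F a) (λ b → if P a then g b else 0) ⟩
    (if valid EB (F a) then (if P a then g (F a) else 0) else 0)
      ≡⟨ image (P a) refl ⟩
    (if P a then f a else 0) ∎)
    where
    image : ∀ x → P a ≡ x → (if valid EB (F a) then (if x then g (F a) else 0) else 0) ≡ (if x then f a else 0)
    image true  pa with forward a va pa
    ... | vFa , _ , _ , fa≡gFa rewrite vFa = sym fa≡gFa
    image false _ with valid EB (F a)
    ... | true  = refl
    ... | false = refl

  collapse : ∀ b → valid EB b ≡ true →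
    ∑ (elems EA) (λ a → if graphG a b then g b else 0) ≡ (if Q b then g b else 0)
  collapse b vb = begin
    ∑ (elems EA) (λ a → if graphG a b then g b else 0)
      ≡⟨ ∑-cong (elems EA) (λ a → if-∧ (eqᵇ EA a (G b)) (Q b) (g b)) ⟩
    ∑ (elems EA) (λ a → if eqᵇ EA a (G b) then (if Q b then g b else 0) else 0)
      ≡⟨ sum-delta EA (G b) (λ _ → if Q b then g b else 0) ⟩
    (if valid EA (G b) then (if Q b then g b else 0) else 0)
      ≡⟨ preimage (Q b) refl ⟩
    (if Q b then g b else 0) ∎
    where
    preimage : ∀ x → Q b ≡ x → (if valid EA (G b) then (if x then g b else 0) else 0) ≡ (if x then g b else 0)
    preimage true  qb rewrite proj₁ (backward b vb qb) = refl
    preimage false _ with valid EA (G b)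
    ... | true  = refl
    ... | false = refl

rangeEnum : ℕ → Enumeration ℕ
rangeEnum n = record
  { elems       = range1 n
  ; valid       = inInterval 1 n
  ; eqᵇ         = _≡ᵇ_
  ; eqᵇ-sound   = ≡ᵇ-sound
  ; eqᵇ-refl    = ≡ᵇ-refl
  ; elems-valid = subst (All (λ y → inInterval 1 n y ≡ true)) (sym (range1≡fromTo n)) (fromTo-inInterval n 1)
  ; sum-delta   = λ y c → trans (cong (λ xs → ∑ xs (λ x → if x ≡ᵇ y then c x else 0)) (range1≡fromTo n))
                                (foldr-delta _+_ 0 +-identityˡ +-identityʳ n 1 y c)
  }

listEqᵇ : List ℕ → List ℕ → Bool
listEqᵇ []       []       = true
listEqᵇ []       (_ ∷ _)  = false
listEqᵇ (_ ∷ _)  []       = false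
listEqᵇ (x ∷ xs) (y ∷ ys) = (x ≡ᵇ y) ∧ listEqᵇ xs ys

listEqᵇ-sound : ∀ xs ys → listEqᵇ xs ys ≡ true → xs ≡ ys
listEqᵇ-sound []       []       e = refl
listEqᵇ-sound (x ∷ xs) (y ∷ ys) e = cong₂ _∷_ (≡ᵇ-sound x y (∧-true-l e)) (listEqᵇ-sound xs ys (∧-true-r {x ≡ᵇ y} e))

listEqᵇ-refl : ∀ xs → listEqᵇ xs xs ≡ true
listEqᵇ-refl []       = refl
listEqᵇ-refl (x ∷ xs) rewrite ≡ᵇ-refl x = listEqᵇ-refl xs

validWord : ℕ → (ℕ → Bool) → List ℕ → Bool
validWord zero    V []       = true
validWord zero    V (_ ∷ _)  = false
validWord (suc r) V []       = false
validWord (suc r) V (y ∷ ys) = V y ∧ validWord r V ys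

validWord-sound : ∀ r (V : ℕ → Bool) ys → validWord r V ys ≡ true → length ys ≡ r × All (λ y → V y ≡ true) ys
validWord-sound zero    V []       e = refl , []
validWord-sound (suc r) V (y ∷ ys) e with validWord-sound r V ys (∧-true-r {V y} e)
... | len , vs = cong suc len , ∧-true-l e ∷ vs

validWord-intro : ∀ r (V : ℕ → Bool) ys → length ys ≡ r → All (λ y → V y ≡ true) ys → validWord r V ys ≡ true
validWord-intro _ V []       refl []       = refl
validWord-intro _ V (y ∷ ys) refl (v ∷ vs) = ∧-true v (validWord-intro _ V ys refl vs)

All-concatMap : {A B : Set} {P : B → Set} (g : A → List B) (xs : List A) →
  All (λ x → All P (g x)) xs → All P (concatMap g xs)
All-concatMap g []       []       = []
All-concatMap g (x ∷ xs) (p ∷ ps) = AllP.++⁺ p (All-concatMap g xs ps)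

wordEnum : ℕ → (E : Enumeration ℕ) → (∀ a b → eqᵇ E a b ≡ (a ≡ᵇ b)) → Enumeration (List ℕ)
wordEnum r E eqE = record
  { elems = lists r (elems E) ; valid = validWord r (valid E) ; eqᵇ = listEqᵇ ; eqᵇ-sound = listEqᵇ-sound
  ; eqᵇ-refl = listEqᵇ-refl ; elems-valid = words-valid r ; sum-delta = words-delta r }
  where
  words-valid : ∀ r → All (λ w → validWord r (valid E) w ≡ true) (lists r (elems E))
  words-valid zero    = refl ∷ []
  words-valid (suc r) = All-concatMap _ (elems E) (All.map (λ vx → AllP.map⁺ (All.map (∧-true vx) (words-valid r))) (elems-valid E))

  words-delta : ∀ r y (c : List ℕ → ℕ) →
    ∑ (lists r (elems E)) (λ w → if listEqᵇ w y then c w else 0) ≡ (if validWord r (valid E) y then c y else 0)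
  words-delta zero    []       c = +-identityʳ (c [])
  words-delta zero    (_ ∷ _)  c = refl
  words-delta (suc r) []       c = trans (∑-concatMap (elems E) _ _)
    (trans (∑-cong (elems E) (λ x → trans (∑-map (lists r (elems E)) (x ∷_) _) (∑-zero (lists r (elems E))))) (∑-zero (elems E)))
  words-delta (suc r) (y ∷ ys) c = begin
    ∑ (concatMap (λ x → map (x ∷_) (lists r (elems E))) (elems E)) (λ w → if listEqᵇ w (y ∷ ys) then c w else 0)
      ≡⟨ ∑-concatMap (elems E) _ _ ⟩
    ∑ (elems E) (λ x → ∑ (map (x ∷_) (lists r (elems E))) (λ w → if listEqᵇ w (y ∷ ys) then c w else 0))
      ≡⟨ ∑-cong (elems E) (λ x → trans (∑-map (lists r (elems E)) (x ∷_) _)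
           (trans (∑-cong (lists r (elems E)) (λ w → if-∧ (x ≡ᵇ y) (listEqᵇ w ys) (c (x ∷ w))))
           (trans (∑-if (lists r (elems E)) (x ≡ᵇ y) _)
             (cong (λ v → if x ≡ᵇ y then v else 0) (words-delta r ys (λ w → c (x ∷ w))))))) ⟩
    ∑ (elems E) (λ x → if x ≡ᵇ y then (if validWord r (valid E) ys then c (x ∷ ys) else 0) else 0)
      ≡⟨ ∑-cong (elems E) (λ x → cong (λ b → if b then (if validWord r (valid E) ys then c (x ∷ ys) else 0) else 0) (sym (eqE x y))) ⟩
    ∑ (elems E) (λ x → if eqᵇ E x y then (if validWord r (valid E) ys then c (x ∷ ys) else 0) else 0)
      ≡⟨ sum-delta E y (λ x → if validWord r (valid E) ys then c (x ∷ ys) else 0) ⟩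
    (if valid E y then (if validWord r (valid E) ys then c (y ∷ ys) else 0) else 0)
      ≡⟨ sym (if-∧ (valid E y) _ _) ⟩
    (if valid E y ∧ validWord r (valid E) ys then c (y ∷ ys) else 0) ∎
    where open ≡-Reasoning

pairEnum : {A B : Set} → Enumeration A → (A → Enumeration B) → Enumeration (A × B)
pairEnum {A} {B} EA EB = record
  { elems       = pairs
  ; valid       = pairValid
  ; eqᵇ         = pairEq
  ; eqᵇ-sound   = pair-sound
  ; eqᵇ-refl    = λ { (a , b) → trans (cong (_∧ eqᵇ (EB a) b b) (eqᵇ-refl EA a)) (eqᵇ-refl (EB a) b) }
  ; elems-valid = All-concatMap _ (elems EA)
                    (All.map (λ va → AllP.map⁺ (All.map (∧-true va) (elems-valid (EB _)))) (elems-valid EA))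
  ; sum-delta   = pair-delta
  }
  where
  pairs : List (A × B)
  pairs = concatMap (λ a → map (a ,_) (elems (EB a))) (elems EA)

  pairValid : A × B → Bool
  pairValid (a , b) = valid EA a ∧ valid (EB a) b

  pairEq : A × B → A × B → Bool
  pairEq (a , b) (a' , b') = eqᵇ EA a a' ∧ eqᵇ (EB a) b b'

  pair-sound : ∀ x y → pairEq x y ≡ true → x ≡ y
  pair-sound (a , b) (a' , b') e with eqᵇ-sound EA a a' (∧-true-l e)
  ... | refl = cong (a ,_) (eqᵇ-sound (EB a) b b' (∧-true-r {eqᵇ EA a a} e))

  pair-delta : ∀ y (c : A × B → ℕ) → ∑ pairs (λ x → if pairEq x y then c x else 0) ≡ (if pairValid y then c y else 0)
  pair-delta (y₁ , y₂) c = begin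
    ∑ pairs (λ x → if pairEq x (y₁ , y₂) then c x else 0)
      ≡⟨ ∑-concatMap (elems EA) _ _ ⟩
    ∑ (elems EA) (λ a → ∑ (map (a ,_) (elems (EB a))) (λ x → if pairEq x (y₁ , y₂) then c x else 0))
      ≡⟨ ∑-cong (elems EA) (λ a → trans (∑-map (elems (EB a)) (a ,_) _)
           (trans (∑-cong (elems (EB a)) (λ b → if-∧ (eqᵇ EA a y₁) (eqᵇ (EB a) b y₂) (c (a , b))))
           (trans (∑-if (elems (EB a)) (eqᵇ EA a y₁) _)
             (cong (λ v → if eqᵇ EA a y₁ then v else 0) (sum-delta (EB a) y₂ (λ b → c (a , b))))))) ⟩
    ∑ (elems EA) (λ a → if eqᵇ EA a y₁ then (if valid (EB a) y₂ then c (a , y₂) else 0) else 0)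
      ≡⟨ sum-delta EA y₁ (λ a → if valid (EB a) y₂ then c (a , y₂) else 0) ⟩
    (if valid EA y₁ then (if valid (EB y₁) y₂ then c (y₁ , y₂) else 0) else 0)
      ≡⟨ if-∧ (valid EA y₁) _ _ ⟨
    (if pairValid (y₁ , y₂) then c (y₁ , y₂) else 0) ∎
    where open ≡-Reasoning

+-swapʳ : ∀ a b c → a + b + c ≡ a + c + b
+-swapʳ a b c = trans (+-assoc a b c) (trans (cong (a +_) (+-comm b c)) (sym (+-assoc a c b)))

-- A list of steps l_j ∈ [1, p) starting from
-- acc determines the residues of its partial sums; conversely those residues determine the
-- steps through the cyclic gap between consecutive residues.  Consecutive residues are
-- always distinct, and each wrap-around (a descent of the residues) adds one to the
-- quotient by p.
module Residues (n : ℕ) where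

  p : ℕ
  p = suc n

  IsStep : ℕ → Set
  IsStep l = 1 ≤ l × l < p

  divmod-unique : ∀ a x q → x < p → a ≡ x + q * p → a % p ≡ x × a / p ≡ q
  divmod-unique a x q x<p refl =
    trans ([m+kn]%n≡m%n x q p) (m<n⇒m%n≡m x<p) ,
    trans (+-distrib-/ x (q * p) x%p+0<p) (cong₂ _+_ (m<n⇒m/n≡0 x<p) (m*n/n≡m q p))
    where
    x%p+0<p : x % p + (q * p) % p < p
    x%p+0<p = subst (_< p) (sym (begin
      x % p + (q * p) % p ≡⟨ cong₂ _+_ (m<n⇒m%n≡m x<p) (m*n%n≡0 q p) ⟩
      x + 0               ≡⟨ +-identityʳ x ⟩
      x                   ∎)) x<p
      where open ≡-Reasoning

  gap : ℕ → ℕ → ℕ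
  gap m x = if m <ᵇ x then x ∸ m else (x + p) ∸ m

  advance : ∀ m q l → m < p → IsStep l → Σ[ x ∈ ℕ ] Σ[ q' ∈ ℕ ]
    m + q * p + l ≡ x + q' * p × x < p × gap m x ≡ l × x ≢ m × q' ≡ q + ind (x <ᵇ m)
  advance m q l m<p (1≤l , l<p) with m + l <? p
  ... | yes m+l<p = m + l , q , +-swapʳ m (q * p) l , m+l<p , gap≡l , (λ e → <⇒≢ m<m+l (sym e)) , q≡
    where
    m<m+l : m < m + l
    m<m+l = m<m+n m 1≤l
    gap≡l : gap m (m + l) ≡ l
    gap≡l rewrite <ᵇ-true m<m+l = m+n∸m≡n m l
    q≡ : q ≡ q + ind (m + l <ᵇ m)
    q≡ rewrite <ᵇ-false {m + l} {m} (λ h → <⇒≱ h (m≤m+n m l)) = sym (+-identityʳ q)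
  ... | no m+l≮p = d , suc q , eq , d<p , gap≡l , <⇒≢ d<m , q≡
    where
    d : ℕ
    d = m + l ∸ p
    d+p≡m+l : d + p ≡ m + l
    d+p≡m+l = m∸n+n≡m (≮⇒≥ m+l≮p)
    d<p : d < p
    d<p = m<n+o⇒m∸n<o (m + l) p (+-mono-< m<p l<p)
    d<m : d < m
    d<m = +-cancelʳ-< p d m (subst (_< m + p) (sym d+p≡m+l) (+-monoʳ-< m l<p))
    eq : m + q * p + l ≡ d + suc q * p
    eq = trans (+-swapʳ m (q * p) l) (trans (cong (_+ q * p) (sym d+p≡m+l)) (+-assoc d p (q * p)))
    gap≡l : gap m d ≡ l
    gap≡l rewrite <ᵇ-false {m} {d} (λ h → <⇒≱ h (<⇒≤ d<m)) | d+p≡m+l = m+n∸m≡n m l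
    q≡ : suc q ≡ q + ind (d <ᵇ m)
    q≡ rewrite <ᵇ-true d<m = sym (+-comm q 1)

  retreat : ∀ m q x → m < p → x < p → x ≢ m →
    m + q * p + gap m x ≡ x + (q + ind (x <ᵇ m)) * p × IsStep (gap m x)
  retreat m q x m<p x<p x≢m with <-cmp m x
  ... | tri< m<x _ _ rewrite <ᵇ-true m<x | <ᵇ-false {x} {m} (<⇒≯ m<x) =
      trans (+-swapʳ m (q * p) (x ∸ m)) (cong₂ _+_ (m+[n∸m]≡n (<⇒≤ m<x)) (cong (_* p) (sym (+-identityʳ q)))) ,
      m<n⇒0<n∸m m<x , ≤-<-trans (m∸n≤m x m) x<p
  ... | tri≈ _ m≡x _ = ⊥-elim (x≢m (sym m≡x))
  ... | tri> _ _ x<m rewrite <ᵇ-false {m} {x} (<⇒≯ x<m) | <ᵇ-true x<m =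
      trans (+-swapʳ m (q * p) (x + p ∸ m))
        (trans (cong (_+ q * p) (m+[n∸m]≡n (≤-trans (<⇒≤ m<p) (m≤n+m p x))))
        (trans (+-assoc x p (q * p)) (cong (λ z → x + z * p) (+-comm 1 q)))) ,
      m<n⇒0<n∸m (≤-trans m<p (m≤n+m p x)) , m<n+o⇒m∸n<o (x + p) m (+-monoˡ-< p x<m)

  residues : ℕ → List ℕ → List ℕ
  residues acc ls = map (_% p) (psums acc ls)

  gaps : ℕ → List ℕ → List ℕ
  gaps m []       = []
  gaps m (x ∷ xs) = gap m x ∷ gaps x xs

  length-gaps : ∀ m xs → length (gaps m xs) ≡ length xs
  length-gaps m []       = refl
  length-gaps m (x ∷ xs) = cong suc (length-gaps x xs)

  advance-mod : ∀ acc l → IsStep l →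
    gap (acc % p) ((acc + l) % p) ≡ l × (acc + l) % p ≢ acc % p ×
    (acc + l) / p ≡ acc / p + ind ((acc + l) % p <ᵇ acc % p)
  advance-mod acc l l-step with advance (acc % p) (acc / p) l (m%n<n acc p) l-step
  ... | x , q' , eq , x<p , gap≡l , x≢m , q'≡ with divmod-unique (acc + l) x q' x<p (trans (cong (_+ l) (m≡m%n+[m/n]*n acc p)) eq)
  ... | r≡x , q≡q' rewrite r≡x | q≡q' = gap≡l , x≢m , q'≡

  retreat-mod : ∀ acc x → x < p → x ≢ acc % p → (acc + gap (acc % p) x) % p ≡ x × IsStep (gap (acc % p) x)
  retreat-mod acc x x<p x≢m with retreat (acc % p) (acc / p) x (m%n<n acc p) x<p x≢m
  ... | eq , step = proj₁ (divmod-unique (acc + gap (acc % p) x) x (acc / p + ind (x <ᵇ acc % p)) x<p (trans (cong (_+ gap (acc % p) x) (m≡m%n+[m/n]*n acc p)) eq)) , step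

  not-≡ᵇ-true⇒≢ : ∀ a b → not (a ≡ᵇ b) ≡ true → b ≢ a
  not-≡ᵇ-true⇒≢ a b e refl rewrite ≡ᵇ-refl a = false≢true e

  ≢⇒not-≡ᵇ-true : ∀ a b → b ≢ a → not (a ≡ᵇ b) ≡ true
  ≢⇒not-≡ᵇ-true a b b≢a rewrite ≡ᵇ-false a b (λ e → b≢a (sym e)) = refl

  residues-encode : ∀ ls acc → All IsStep ls →
    gaps (acc % p) (residues acc ls) ≡ ls × adjDistinct (acc % p ∷ residues acc ls) ≡ true ×
    (acc + sum ls) / p ≡ acc / p + descents (acc % p ∷ residues acc ls)
  residues-encode []       acc []       = refl , refl , trans (cong (_/ p) (+-identityʳ acc)) (sym (+-identityʳ _))
  residues-encode (l ∷ ls) acc (s ∷ ss) with advance-mod acc l s | residues-encode ls (acc + l) ss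
  ... | gap≡l , r≢ , q≡ | gaps≡ , adj , quot =
    cong₂ _∷_ gap≡l gaps≡ , ∧-true (≢⇒not-≡ᵇ-true (acc % p) ((acc + l) % p) r≢) adj ,
    (begin
      (acc + (l + sum ls)) / p ≡⟨ cong (_/ p) (sym (+-assoc acc l (sum ls))) ⟩
      (acc + l + sum ls) / p   ≡⟨ quot ⟩
      (acc + l) / p + descents ((acc + l) % p ∷ residues (acc + l) ls)
        ≡⟨ cong (_+ descents ((acc + l) % p ∷ residues (acc + l) ls)) q≡ ⟩
      acc / p + ind ((acc + l) % p <ᵇ acc % p) + descents ((acc + l) % p ∷ residues (acc + l) ls)
        ≡⟨ +-assoc (acc / p) _ _ ⟩
      acc / p + descents (acc % p ∷ residues acc (l ∷ ls)) ∎)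
    where open ≡-Reasoning

  residues-decode : ∀ M acc → All (_< p) M → adjDistinct (acc % p ∷ M) ≡ true →
    All IsStep (gaps (acc % p) M) × residues acc (gaps (acc % p) M) ≡ M
  residues-decode []      acc []         _   = [] , refl
  residues-decode (x ∷ M) acc (x<p ∷ ps) adj
    with retreat-mod acc x x<p (not-≡ᵇ-true⇒≢ (acc % p) x (∧-true-l adj))
  ... | r≡x , step
    with subst (λ z → All IsStep (gaps z M) × residues (acc + gap (acc % p) x) (gaps z M) ≡ M) r≡x
           (residues-decode M (acc + gap (acc % p) x) ps
             (subst (λ z → adjDistinct (z ∷ M) ≡ true) (sym r≡x) (∧-true-r {not (acc % p ≡ᵇ x)} adj)))
  ... | steps , res≡ = step ∷ steps , cong₂ _∷_ r≡x res≡

mem : ℕ → List ℕ → Bool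
mem x xs = any (x ≡ᵇ_) xs

mem-here : ∀ x xs → mem x (x ∷ xs) ≡ true
mem-here x xs rewrite ≡ᵇ-refl x = refl

mem-there : ∀ x y xs → mem x xs ≡ true → mem x (y ∷ xs) ≡ true
mem-there x y xs e rewrite e = BoolP.∨-zeroʳ (x ≡ᵇ y)

mem-cases : ∀ x y xs → mem x (y ∷ xs) ≡ true → x ≡ y ⊎ mem x xs ≡ true
mem-cases x y xs e with x ≡ᵇ y in e₁
... | true  = inj₁ (≡ᵇ-sound x y e₁)
... | false = inj₂ e

mem-All : {P : ℕ → Set} → ∀ {x} xs → All P xs → mem x xs ≡ true → P x
mem-All {x = x} (y ∷ xs) (py ∷ ps) e with mem-cases x y xs e
... | inj₁ refl = py
... | inj₂ e'   = mem-All xs ps e'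

mem-self : ∀ xs → All (λ x → mem x xs ≡ true) xs
mem-self []       = []
mem-self (x ∷ xs) = mem-here x xs ∷ All.map (λ {y} → mem-there y x xs) (mem-self xs)

mem-map : ∀ (f : ℕ → ℕ) {x} xs → mem x xs ≡ true → mem (f x) (map f xs) ≡ true
mem-map f {x} (y ∷ xs) e with mem-cases x y xs e
... | inj₁ refl = mem-here (f y) (map f xs)
... | inj₂ e'   = mem-there (f x) (f y) (map f xs) (mem-map f xs e')

mem-map⁻ : ∀ (f : ℕ → ℕ) {y} xs → mem y (map f xs) ≡ true → Σ[ x ∈ ℕ ] mem x xs ≡ true × f x ≡ y
mem-map⁻ f {y} (x ∷ xs) e with mem-cases y (f x) (map f xs) e
... | inj₁ refl = x , mem-here x xs , refl
... | inj₂ e' with mem-map⁻ f xs e'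
...   | z , mz , fz≡y = z , mem-there z x xs mz , fz≡y

mem-filter⁺ : ∀ (Q : ℕ → Bool) {x} xs → mem x xs ≡ true → Q x ≡ true → mem x (filterᵇ Q xs) ≡ true
mem-filter⁺ Q {x} (y ∷ xs) e qx with mem-cases x y xs e
... | inj₁ refl rewrite qx = mem-here x (filterᵇ Q xs)
... | inj₂ e' with Q y
...   | true  = mem-there x y (filterᵇ Q xs) (mem-filter⁺ Q xs e' qx)
...   | false = mem-filter⁺ Q xs e' qx

mem-fromTo : ∀ k a y → a ≤ y → y < a + k → mem y (fromTo a k) ≡ true
mem-fromTo zero    a y a≤y y<a+0 = ⊥-elim (<⇒≱ (subst (y <_) (+-identityʳ a) y<a+0) a≤y)
mem-fromTo (suc k) a y a≤y y<a+k with <-cmp a y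
... | tri≈ _ refl _ = mem-here a (fromTo (suc a) k)
... | tri< a<y _ _  = mem-there y a (fromTo (suc a) k) (mem-fromTo k (suc a) y a<y (subst (y <_) (+-suc a k) y<a+k))
... | tri> _ _ a>y  = ⊥-elim (<⇒≱ a>y a≤y)

mem-range1 : ∀ n x → inInterval 1 n x ≡ true → mem x (range1 n) ≡ true
mem-range1 n x h = subst (λ xs → mem x xs ≡ true) (sym (range1≡fromTo n))
  (mem-fromTo n 1 x (proj₁ (inInterval-sound 1 n x h)) (proj₂ (inInterval-sound 1 n x h)))

Ascending : ℕ → List ℕ → Set
Ascending a []      = ⊤
Ascending a (x ∷ v) = a < x × Ascending x v

Ascending-weaken : ∀ {a b} v → a ≤ b → Ascending b v → Ascending a v
Ascending-weaken []      a≤b _         = tt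
Ascending-weaken (x ∷ v) a≤b (b<x , s) = ≤-<-trans a≤b b<x , s

Ascending-All : ∀ {a} v → Ascending a v → All (a <_) v
Ascending-All []      _         = []
Ascending-All (x ∷ v) (a<x , s) = a<x ∷ All.map (<-trans a<x) (Ascending-All v s)

Ascending-fromTo : ∀ k a b → b < a → Ascending b (fromTo a k)
Ascending-fromTo zero    a b b<a = tt
Ascending-fromTo (suc k) a b b<a = b<a , Ascending-fromTo k (suc a) a ≤-refl

Ascending-filter : ∀ (Q : ℕ → Bool) {a} xs → Ascending a xs → Ascending a (filterᵇ Q xs)
Ascending-filter Q []       _         = tt
Ascending-filter Q (x ∷ xs) (a<x , s) with Q x
... | true  = a<x , Ascending-filter Q xs s
... | false = Ascending-filter Q xs (Ascending-weaken xs (<⇒≤ a<x) s)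

mem-false : ∀ a v → All (a <_) v → mem a v ≡ false
mem-false a []      []           = refl
mem-false a (x ∷ v) (a<x ∷ a<v) rewrite ≡ᵇ-false a x (<⇒≢ a<x) = mem-false a v a<v

filter-congAll : (P Q : ℕ → Bool) → ∀ xs → All (λ y → P y ≡ Q y) xs → filterᵇ P xs ≡ filterᵇ Q xs
filter-congAll P Q []       []       = refl
filter-congAll P Q (x ∷ xs) (e ∷ es) with Q x
... | true  rewrite e = cong (x ∷_) (filter-congAll P Q xs es)
... | false rewrite e = filter-congAll P Q xs es

shift-bounds : ∀ a k {y} → a < y × (a ≤ y × y < a + suc k) → suc a ≤ y × y < suc a + k
shift-bounds a k {y} (a<y , _ , y<a+1+k) = a<y , subst (y <_) (+-suc a k) y<a+1+k

filter-fromTo-mem : ∀ k a {b} v → Ascending b v → All (λ x → a ≤ x × x < a + k) v →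
  filterᵇ (λ x → mem x v) (fromTo a k) ≡ v
filter-fromTo-mem zero    a []      _       _                  = refl
filter-fromTo-mem zero    a (x ∷ v) _       ((a≤x , x<a+0) ∷ _) = ⊥-elim (<⇒≱ (subst (x <_) (+-identityʳ a) x<a+0) a≤x)
filter-fromTo-mem (suc k) a []      _       _                  = filter-fromTo-mem k (suc a) {0} [] tt []
filter-fromTo-mem (suc k) a (x ∷ v) (_ , s) ((a≤x , x<a+k) ∷ bounds) with <-cmp a x
... | tri≈ _ refl _ rewrite mem-here a v =
  cong (a ∷_) (trans (filter-congAll _ _ (fromTo (suc a) k) (All.map (λ {y} → drop-head {y}) (fromTo-inInterval k (suc a))))
                     (filter-fromTo-mem k (suc a) v s (All.zipWith (shift-bounds a k) (Ascending-All v s , bounds))))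
  where
  drop-head : ∀ {y} → inInterval (suc a) k y ≡ true → mem y (a ∷ v) ≡ mem y v
  drop-head {y} h = cong (_∨ mem y v) (≡ᵇ-false y a (λ y≡a → <⇒≢ (proj₁ (inInterval-sound (suc a) k y h)) (sym y≡a)))
... | tri< a<x _ _ rewrite mem-false a (x ∷ v) (Ascending-All (x ∷ v) (a<x , s)) =
  filter-fromTo-mem k (suc a) (x ∷ v) (a<x , s)
    (All.zipWith (shift-bounds a k) (Ascending-All (x ∷ v) (a<x , s) , (a≤x , x<a+k) ∷ bounds))
... | tri> _ _ a>x = ⊥-elim (<⇒≱ a>x a≤x)

nth : List ℕ → ℕ → ℕ
nth []      _       = 0
nth (x ∷ v) zero    = x
nth (x ∷ v) (suc t) = nth v t

nth-mem : ∀ v t → t < length v → mem (nth v t) v ≡ true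
nth-mem (x ∷ v) zero    _         = mem-here x v
nth-mem (x ∷ v) (suc t) (s≤s t<v) = mem-there (nth v t) x v (nth-mem v t t<v)

nth-mono : ∀ {a} v t t' → Ascending a v → t < t' → t' < length v → nth v t < nth v t'
nth-mono (x ∷ v) zero    (suc t') (_ , s) _          (s≤s t'<v) = mem-All v (Ascending-All v s) (nth-mem v t' t'<v)
nth-mono (x ∷ v) (suc t) (suc t') (_ , s) (s≤s t<t') (s≤s t'<v) = nth-mono v t t' s t<t' t'<v

rank : ℕ → List ℕ → ℕ
rank x []      = 0
rank x (y ∷ v) = ind (y <ᵇ x) + rank x v

rank-zero : ∀ x v → All (x ≤_) v → rank x v ≡ 0
rank-zero x []      []           = refl
rank-zero x (y ∷ v) (x≤y ∷ x≤v) rewrite <ᵇ-false {y} {x} (λ y<x → <⇒≱ y<x x≤y) = rank-zero x v x≤v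

rank-≤-length : ∀ x v → rank x v ≤ length v
rank-≤-length x []      = z≤n
rank-≤-length x (y ∷ v) with y <ᵇ x
... | true  = s≤s (rank-≤-length x v)
... | false = m≤n⇒m≤1+n (rank-≤-length x v)

rank-mono : ∀ x y v → x ≤ y → rank x v ≤ rank y v
rank-mono x y []      x≤y = z≤n
rank-mono x y (z ∷ v) x≤y with z <ᵇ x in e₁ | z <ᵇ y in e₂
... | true  | true  = s≤s (rank-mono x y v x≤y)
... | false | true  = m≤n⇒m≤1+n (rank-mono x y v x≤y)
... | false | false = rank-mono x y v x≤y
... | true  | false = ⊥-elim (<⇒≱ (<ᵇ-sound z x e₁) (≤-trans x≤y (<ᵇ-false⇒≥ e₂)))

rank-strict : ∀ x y v → mem x v ≡ true → x < y → rank x v < rank y v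
rank-strict x y (z ∷ v) m x<y with mem-cases x z v m
... | inj₁ refl rewrite <ᵇ-false {x} {x} (<-irrefl refl) | <ᵇ-true x<y = s≤s (rank-mono x y v (<⇒≤ x<y))
... | inj₂ m' with z <ᵇ x in e₁ | z <ᵇ y in e₂
...   | true  | true  = s≤s (rank-strict x y v m' x<y)
...   | false | true  = m≤n⇒m≤1+n (rank-strict x y v m' x<y)
...   | false | false = rank-strict x y v m' x<y
...   | true  | false = ⊥-elim (<⇒≱ (<ᵇ-sound z x e₁) (≤-trans (<⇒≤ x<y) (<ᵇ-false⇒≥ e₂)))

rank-lt : ∀ x v → mem x v ≡ true → rank x v < length v
rank-lt x (y ∷ v) m with mem-cases x y v m
... | inj₁ refl rewrite <ᵇ-false {x} {x} (<-irrefl refl) = s≤s (rank-≤-length x v)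
... | inj₂ m' with y <ᵇ x
...   | true  = s≤s (rank-lt x v m')
...   | false = m≤n⇒m≤1+n (rank-lt x v m')

rank-nth : ∀ {a} v t → Ascending a v → t < length v → rank (nth v t) v ≡ t
rank-nth (x ∷ v) zero    (_ , s) _ rewrite <ᵇ-false {x} {x} (<-irrefl refl) =
  rank-zero x v (All.map <⇒≤ (Ascending-All v s))
rank-nth (x ∷ v) (suc t) (_ , s) (s≤s t<v)
  rewrite <ᵇ-true {x} {nth v t} (mem-All v (Ascending-All v s) (nth-mem v t t<v)) = cong suc (rank-nth v t s t<v)

nth-rank : ∀ {a} x v → Ascending a v → mem x v ≡ true → nth v (rank x v) ≡ x
nth-rank x (y ∷ v) (_ , s) m with mem-cases x y v m
... | inj₁ refl rewrite <ᵇ-false {x} {x} (<-irrefl refl) | rank-zero x v (All.map <⇒≤ (Ascending-All v s)) = refl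
... | inj₂ m'   rewrite <ᵇ-true {y} {x} (mem-All v (Ascending-All v s) m') = nth-rank x v s m'

module StrictlyMonotone (S : ℕ → Set) (f : ℕ → ℕ) (mono : ∀ a b → S a → S b → a < b → f a < f b) where

  <ᵇ-preserved : ∀ a b → S a → S b → (f a <ᵇ f b) ≡ (a <ᵇ b)
  <ᵇ-preserved a b sa sb with <-cmp a b
  ... | tri< a<b _ _  rewrite <ᵇ-true a<b = <ᵇ-true (mono a b sa sb a<b)
  ... | tri≈ _ refl _ rewrite <ᵇ-false {a} {a} (<-irrefl refl) = <ᵇ-false {f a} {f a} (<-irrefl refl)
  ... | tri> _ _ b<a  rewrite <ᵇ-false {a} {b} (<⇒≯ b<a) = <ᵇ-false (<⇒≯ (mono b a sb sa b<a))

  ≡ᵇ-preserved : ∀ a b → S a → S b → (f a ≡ᵇ f b) ≡ (a ≡ᵇ b)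
  ≡ᵇ-preserved a b sa sb with <-cmp a b
  ... | tri< a<b a≢b _ rewrite ≡ᵇ-false a b a≢b = ≡ᵇ-false (f a) (f b) (<⇒≢ (mono a b sa sb a<b))
  ... | tri≈ _ refl _  rewrite ≡ᵇ-refl a = ≡ᵇ-refl (f a)
  ... | tri> _ a≢b b<a rewrite ≡ᵇ-false a b a≢b = ≡ᵇ-false (f a) (f b) (λ e → <⇒≢ (mono b a sb sa b<a) (sym e))

  descents-map : ∀ φ → All S φ → descents (map f φ) ≡ descents φ
  descents-map []          _                 = refl
  descents-map (x ∷ [])    _                 = refl
  descents-map (x ∷ y ∷ φ) (sx ∷ sy ∷ ss) =
    cong₂ _+_ (cong ind (<ᵇ-preserved y x sy sx)) (descents-map (y ∷ φ) (sy ∷ ss))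

  adjDistinct-map : ∀ φ → All S φ → adjDistinct (map f φ) ≡ adjDistinct φ
  adjDistinct-map []          _             = refl
  adjDistinct-map (x ∷ [])    _             = refl
  adjDistinct-map (x ∷ y ∷ φ) (sx ∷ sy ∷ ss) =
    cong₂ _∧_ (cong not (≡ᵇ-preserved x y sx sy)) (adjDistinct-map (y ∷ φ) (sy ∷ ss))

differences : ℕ → List ℕ → List ℕ
differences acc []      = []
differences acc (x ∷ v) = (x ∸ acc) ∷ differences x v

length-psums : ∀ acc ls → length (psums acc ls) ≡ length ls
length-psums acc []       = refl
length-psums acc (l ∷ ls) = cong suc (length-psums (acc + l) ls)

length-differences : ∀ acc v → length (differences acc v) ≡ length v
length-differences acc []      = refl
length-differences acc (x ∷ v) = cong suc (length-differences x v)

differences-psums : ∀ acc ls → differences acc (psums acc ls) ≡ ls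
differences-psums acc []       = refl
differences-psums acc (l ∷ ls) = cong₂ _∷_ (m+n∸m≡n acc l) (differences-psums (acc + l) ls)

psums-differences : ∀ acc v → Ascending acc v → psums acc (differences acc v) ≡ v
psums-differences acc []      _           = refl
psums-differences acc (x ∷ v) (acc<x , s) rewrite m+[n∸m]≡n (<⇒≤ acc<x) = cong (x ∷_) (psums-differences x v s)

psums-ascending : ∀ acc ls → All (1 ≤_) ls → Ascending acc (psums acc ls)
psums-ascending acc []       []       = tt
psums-ascending acc (l ∷ ls) (p ∷ ps) = m<m+n acc p , psums-ascending (acc + l) ls ps

psums-bounded : ∀ acc ls → All (_≤ acc + sum ls) (psums acc ls)
psums-bounded acc []       = []
psums-bounded acc (l ∷ ls) = ≤-trans (m≤m+n (acc + l) (sum ls)) (≤-reflexive assoc)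
  ∷ All.map (λ h → ≤-trans h (≤-reflexive assoc)) (psums-bounded (acc + l) ls)
  where assoc = +-assoc acc l (sum ls)

total-mem-psums : ∀ acc ls → 1 ≤ length ls → mem (acc + sum ls) (psums acc ls) ≡ true
total-mem-psums acc (l ∷ [])      _ rewrite +-identityʳ l = mem-here (acc + l) []
total-mem-psums acc (l ∷ l' ∷ ls) _ = mem-there (acc + sum (l ∷ l' ∷ ls)) (acc + l) (psums (acc + l) (l' ∷ ls))
  (subst (λ z → mem z (psums (acc + l) (l' ∷ ls)) ≡ true) (+-assoc acc l (l' + sum ls))
         (total-mem-psums (acc + l) (l' ∷ ls) (s≤s z≤n)))

differences-steps : ∀ P acc v → Ascending acc v → All (_< P) v → All (λ d → 1 ≤ d × d < P) (differences acc v)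
differences-steps P acc []      _           _            = []
differences-steps P acc (x ∷ v) (acc<x , s) (x<P ∷ v<P) =
  (m<n⇒0<n∸m acc<x , ≤-<-trans (m∸n≤m x acc) x<P) ∷ differences-steps P x v s v<P

differences-total : ∀ P acc v → Ascending acc v → All (_< P) v → acc < P → acc + sum (differences acc v) < P
differences-total P acc []      _           _            acc<P = subst (_< P) (sym (+-identityʳ acc)) acc<P
differences-total P acc (x ∷ v) (acc<x , s) (x<P ∷ v<P) _     =
  subst (_< P) (trans (cong (_+ sum (differences x v)) (sym (m+[n∸m]≡n (<⇒≤ acc<x))))
                      (+-assoc acc (x ∸ acc) (sum (differences x v))))
        (differences-total P x v s v<P x<P)

-- An ascending list all of whose entries occur in M is at most as long as M
-- (double counting of the pairs (x, y) with x = y).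
-- count-eq y xs: the number of entries of xs equal to y.
count-eq : ℕ → List ℕ → ℕ
count-eq y xs = ∑ xs (λ x → ind (x ≡ᵇ y))

count-eq-≥1 : ∀ x M → mem x M ≡ true → 1 ≤ ∑ M (λ y → ind (x ≡ᵇ y))
count-eq-≥1 x (y ∷ M) e with x ≡ᵇ y
... | true  = s≤s z≤n
... | false = count-eq-≥1 x M e

count-eq-≤1 : ∀ {a} v y → Ascending a v → count-eq y v ≤ 1
count-eq-≤1 []      y _       = z≤n
count-eq-≤1 (x ∷ v) y (_ , s) with x ≡ᵇ y in e
... | true rewrite ≡ᵇ-sound x y e = ≤-reflexive (cong suc (trans
        (∑-cong-All v (Ascending-All v s) (λ z y<z → cong ind (≡ᵇ-false z y (λ z≡y → <⇒≢ y<z (sym z≡y)))))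
        (∑-zero v)))
... | false = count-eq-≤1 v y (Ascending-weaken v z≤n s)

∑-mono : ∀ {P : ℕ → Set} xs {f g : ℕ → ℕ} → All P xs → (∀ x → P x → f x ≤ g x) → ∑ xs f ≤ ∑ xs g
∑-mono []       _        h = z≤n
∑-mono (x ∷ xs) (p ∷ ps) h = +-mono-≤ (h x p) (∑-mono xs ps h)

∑-one : ∀ (xs : List ℕ) → ∑ xs (λ _ → 1) ≡ length xs
∑-one []       = refl
∑-one (x ∷ xs) = cong suc (∑-one xs)

ascending-length-≤ : ∀ {a} v M → Ascending a v → All (λ x → mem x M ≡ true) v → length v ≤ length M
ascending-length-≤ v M s v⊆M = begin
  length v                                   ≡⟨ ∑-one v ⟨
  ∑ v (λ _ → 1)                              ≤⟨ ∑-mono v v⊆M (λ x → count-eq-≥1 x M) ⟩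
  ∑ v (λ x → ∑ M (λ y → ind (x ≡ᵇ y)))        ≡⟨ ∑-swap v M _ ⟩
  ∑ M (λ y → count-eq y v)                   ≤⟨ ∑-mono M (All.universal (λ _ → tt) M) (λ y _ → count-eq-≤1 v y s) ⟩
  ∑ M (λ _ → 1)                              ≡⟨ ∑-one M ⟩
  length M                                   ∎
  where open ≤-Reasoning

∏ : List ℕ → (ℕ → ℕ) → ℕ
∏ xs f = product (map f xs)

∏-cong : ∀ xs {f g : ℕ → ℕ} → (∀ x → f x ≡ g x) → ∏ xs f ≡ ∏ xs g
∏-cong []       e = refl
∏-cong (x ∷ xs) e = cong₂ _*_ (e x) (∏-cong xs e)

∏-one : ∀ xs → ∏ xs (λ _ → 1) ≡ 1
∏-one []       = refl
∏-one (x ∷ xs) = trans (+-identityʳ _) (∏-one xs)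

∏-* : ∀ xs (f g : ℕ → ℕ) → ∏ xs (λ x → f x * g x) ≡ ∏ xs f * ∏ xs g
∏-* []       f g = refl
∏-* (x ∷ xs) f g rewrite ∏-* xs f g = *-interchange (f x) (g x) (∏ xs f) (∏ xs g)
  where
  *-interchange : ∀ a b c d → a * b * (c * d) ≡ a * c * (b * d)
  *-interchange a b c d = trans (*-assoc a b (c * d)) (trans (cong (a *_) (trans (sym (*-assoc b c d))
    (trans (cong (_* d) (*-comm b c)) (*-assoc c b d)))) (sym (*-assoc a c (b * d))))

mergedExponent : List ℕ → List ℕ → ℕ → ℕ
mergedExponent ks φ t = sum (map proj₁ (filterᵇ (λ kf → proj₂ kf ≡ᵇ t) (zip ks φ)))

mergedExponent-∷ : ∀ k ks j φ t → mergedExponent (k ∷ ks) (j ∷ φ) t ≡ (if j ≡ᵇ t then k else 0) + mergedExponent ks φ t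
mergedExponent-∷ k ks j φ t with j ≡ᵇ t
... | true  = refl
... | false = refl

pow-if : ∀ b u k → u ^ (if b then k else 0) ≡ (if b then u ^ k else 1)
pow-if true  u k = refl
pow-if false u k = refl

regroup : ∀ s (u : ℕ → ℕ) ks φ → length ks ≡ length φ → All (λ j → inInterval 1 s j ≡ true) φ →
  product (zipWith (λ j k → u j ^ k) φ ks) ≡ ∏ (fromTo 1 s) (λ t → u t ^ mergedExponent ks φ t)
regroup s u []       []      _ _        = sym (∏-one (fromTo 1 s))
regroup s u (k ∷ ks) (j ∷ φ) e (j∈ ∷ φ∈) = sym (begin
  ∏ (fromTo 1 s) (λ t → u t ^ mergedExponent (k ∷ ks) (j ∷ φ) t)
    ≡⟨ ∏-cong (fromTo 1 s) split-exponent ⟩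
  ∏ (fromTo 1 s) (λ t → (if t ≡ᵇ j then u t ^ k else 1) * u t ^ mergedExponent ks φ t)
    ≡⟨ ∏-* (fromTo 1 s) _ _ ⟩
  ∏ (fromTo 1 s) (λ t → if t ≡ᵇ j then u t ^ k else 1) * ∏ (fromTo 1 s) (λ t → u t ^ mergedExponent ks φ t)
    ≡⟨ cong₂ _*_ (trans (foldr-delta _*_ 1 *-identityˡ *-identityʳ s 1 j (λ t → u t ^ k))
                        (cong (λ b → if b then u j ^ k else 1) j∈))
                 (sym (regroup s u ks φ (suc-injective e) φ∈)) ⟩
  u j ^ k * product (zipWith (λ j k → u j ^ k) φ ks) ∎)
  where
  open ≡-Reasoning
  split-exponent : ∀ t → u t ^ mergedExponent (k ∷ ks) (j ∷ φ) t ≡ (if t ≡ᵇ j then u t ^ k else 1) * u t ^ mergedExponent ks φ t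
  split-exponent t = begin
    u t ^ mergedExponent (k ∷ ks) (j ∷ φ) t
      ≡⟨ cong (u t ^_) (mergedExponent-∷ k ks j φ t) ⟩
    u t ^ ((if j ≡ᵇ t then k else 0) + mergedExponent ks φ t)
      ≡⟨ ^-distribˡ-+-* (u t) (if j ≡ᵇ t then k else 0) (mergedExponent ks φ t) ⟩
    u t ^ (if j ≡ᵇ t then k else 0) * u t ^ mergedExponent ks φ t
      ≡⟨ cong (_* u t ^ mergedExponent ks φ t) (trans (pow-if (j ≡ᵇ t) (u t) k)
                                                   (cong (λ b → if b then u t ^ k else 1) (≡ᵇ-sym j t))) ⟩
    (if t ≡ᵇ j then u t ^ k else 1) * u t ^ mergedExponent ks φ t ∎

nth-tabulate : ∀ v a → map (λ t → nth v (t ∸ a)) (fromTo a (length v)) ≡ v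
nth-tabulate []      a = refl
nth-tabulate (x ∷ v) a = cong₂ _∷_ (cong (nth (x ∷ v)) (n∸n≡0 a)) (begin
  map (λ t → nth (x ∷ v) (t ∸ a)) (fromTo (suc a) (length v))
    ≡⟨ ListP.map-cong-local (All.map (λ {t} h → cong (nth (x ∷ v)) (+-∸-assoc 1 (proj₁ (inInterval-sound (suc a) (length v) t h))))
                                     (fromTo-inInterval (length v) (suc a))) ⟩
  map (λ t → nth v (t ∸ suc a)) (fromTo (suc a) (length v))
    ≡⟨ nth-tabulate v (suc a) ⟩
  v ∎)
  where open ≡-Reasoning

zipWith-diagonal : (h : ℕ → ℕ → ℕ) (xs : List ℕ) → zipWith h xs xs ≡ map (λ x → h x x) xs
zipWith-diagonal h []       = refl
zipWith-diagonal h (x ∷ xs) = cong (h x x ∷_) (zipWith-diagonal h xs)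

zipWith-mapˡ : (h : ℕ → ℕ → ℕ) (f : ℕ → ℕ) (xs ks : List ℕ) → zipWith h (map f xs) ks ≡ zipWith (λ x k → h (f x) k) xs ks
zipWith-mapˡ h f []       ks       = refl
zipWith-mapˡ h f (x ∷ xs) []       = refl
zipWith-mapˡ h f (x ∷ xs) (k ∷ ks) = cong (h (f x) k ∷_) (zipWith-mapˡ h f xs ks)

merge-product : ∀ (w : ℕ → ℕ) s v ks φ → length v ≡ s → length ks ≡ length φ → All (λ j → inInterval 1 s j ≡ true) φ →
  product (zipWith (λ x k → w x ^ k) v (merge ks s φ)) ≡ product (zipWith (λ x k → w x ^ k) (map (λ j → nth v (j ∸ 1)) φ) ks)
merge-product w s v ks φ refl len φ∈ = begin
  product (zipWith (λ x k → w x ^ k) v (map (mergedExponent ks φ) (range1 s)))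
    ≡⟨ cong₂ (λ v' r → product (zipWith (λ x k → w x ^ k) v' (map (mergedExponent ks φ) r))) (sym (nth-tabulate v 1)) (range1≡fromTo s) ⟩
  product (zipWith (λ x k → w x ^ k) (map value (fromTo 1 s)) (map (mergedExponent ks φ) (fromTo 1 s)))
    ≡⟨ cong product (trans (ListP.zipWith-map (λ x k → w x ^ k) value (mergedExponent ks φ) (fromTo 1 s) (fromTo 1 s))
                           (zipWith-diagonal _ (fromTo 1 s))) ⟩
  ∏ (fromTo 1 s) (λ t → w (value t) ^ mergedExponent ks φ t)
    ≡⟨ regroup s (λ j → w (value j)) ks φ len φ∈ ⟨
  product (zipWith (λ j k → w (value j) ^ k) φ ks)
    ≡⟨ cong product (zipWith-mapˡ (λ x k → w x ^ k) value φ ks) ⟨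
  product (zipWith (λ x k → w x ^ k) (map value φ) ks) ∎
  where
  open ≡-Reasoning
  value : ℕ → ℕ
  value j = nth v (j ∸ 1)

pow-mod : ∀ n x e → ((x % suc n) ^ e) % suc n ≡ (x ^ e) % suc n
pow-mod n x zero    = refl
pow-mod n x (suc e) = begin
  (x % p * (x % p) ^ e) % p             ≡⟨ %-distribˡ-* (x % p) ((x % p) ^ e) p ⟩
  ((x % p % p) * ((x % p) ^ e % p)) % p ≡⟨ cong₂ (λ a b → (a * b) % p) (m%n%n≡m%n x p) (pow-mod n x e) ⟩
  ((x % p) * (x ^ e % p)) % p           ≡⟨ %-distribˡ-* x (x ^ e) p ⟨
  (x * x ^ e) % p                       ∎
  where
  open ≡-Reasoning
  p = suc n

∑-mod : ∀ n {A : Set} (xs : List A) (f : A → ℕ) → (∑ xs (λ a → f a % suc n)) % suc n ≡ (∑ xs f) % suc n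
∑-mod n []       f = refl
∑-mod n (a ∷ xs) f = begin
  (f a % p + ∑ xs (λ a → f a % p)) % p          ≡⟨ %-distribˡ-+ (f a % p) _ p ⟩
  (f a % p % p + ∑ xs (λ a → f a % p) % p) % p  ≡⟨ cong₂ (λ x y → (x + y) % p) (m%n%n≡m%n (f a) p) (∑-mod n xs f) ⟩
  (f a % p + ∑ xs f % p) % p                    ≡⟨ %-distribˡ-+ (f a) (∑ xs f) p ⟨
  (f a + ∑ xs f) % p                            ∎
  where
  open ≡-Reasoning
  p = suc n

termOf : ℕ → List ℕ → List ℕ → ℕ
termOf p ks Ls = product (zipWith (λ L k → invP p L ^ k) Ls ks)

termOf-residues : ∀ n ks Ls → termOf (suc n) ks (map (_% suc n) Ls) ≡ termOf (suc n) ks Ls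
termOf-residues n ks Ls = cong product (trans (zipWith-mapˡ (λ x k → invP (suc n) x ^ k) (_% suc n) Ls ks)
  (ListP.zipWith-cong (λ x k → cong (_^ k) (pow-mod n x (suc n ∸ 2))) Ls ks))

quotient-in-block : ∀ n S i → 1 ≤ i → (i ∸ 1) * suc n < S → S < i * suc n → S / suc n ≡ i ∸ 1
quotient-in-block n S (suc i) _ lo hi = ≤-antisym (≤-pred (m<n*o⇒m/o<n hi)) i≤q
  where
  p = suc n
  q = S / p
  S<[q+1]p : S < suc q * p
  S<[q+1]p = subst (_< suc q * p) (sym (m≡m%n+[m/n]*n S p)) (+-monoˡ-< (q * p) (m%n<n S p))
  i≤q : i ≤ q
  i≤q = ≤-pred (*-cancelʳ-< p i (suc q) (<-trans lo S<[q+1]p))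

block-of-quotient : ∀ n S i → 1 ≤ i → 1 ≤ S % suc n → S / suc n ≡ i ∸ 1 → (i ∸ 1) * suc n < S × S < i * suc n
block-of-quotient n S i 1≤i 1≤S%p S/p≡ = lower , upper
  where
  p = suc n
  S≡ : S ≡ S % p + (i ∸ 1) * p
  S≡ = trans (m≡m%n+[m/n]*n S p) (cong (λ q → S % p + q * p) S/p≡)
  lower : (i ∸ 1) * p < S
  lower = subst ((i ∸ 1) * p <_) (sym S≡) (+-monoˡ-≤ ((i ∸ 1) * p) 1≤S%p)
  upper : S < i * p
  upper = subst₂ _<_ (sym S≡) (cong (_* p) (trans (+-comm 1 (i ∸ 1)) (m∸n+n≡m 1≤i))) (+-monoˡ-< ((i ∸ 1) * p) (m%n<n S p))

all-sound : ∀ (f : ℕ → Bool) xs → all f xs ≡ true → All (λ x → f x ≡ true) xs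
all-sound f []       e = []
all-sound f (x ∷ xs) e = ∧-true-l e ∷ all-sound f xs (∧-true-r {f x} e)

all-intro : ∀ (f : ℕ → Bool) xs → All (λ x → f x ≡ true) xs → all f xs ≡ true
all-intro f []       []       = refl
all-intro f (x ∷ xs) (p ∷ ps) = ∧-true p (all-intro f xs ps)

All-filterᵇ : ∀ (Q : ℕ → Bool) xs → All (λ x → Q x ≡ true) (filterᵇ Q xs)
All-filterᵇ Q []       = []
All-filterᵇ Q (x ∷ xs) with Q x in e
... | true  = e ∷ All-filterᵇ Q xs
... | false = All-filterᵇ Q xs

position-suc-pred : ∀ {s} j → inInterval 1 s j ≡ true → suc (j ∸ 1) ≡ j
position-suc-pred {s} j h = trans (+-comm 1 (j ∸ 1)) (m∸n+n≡m (proj₁ (inInterval-sound 1 s j h)))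

position-index : ∀ {s} j → inInterval 1 s j ≡ true → j ∸ 1 < s
position-index {s} j h = subst (_≤ s) (sym (position-suc-pred j h)) (≤-pred (proj₂ (inInterval-sound 1 s j h)))

-- A word M over ascending values v (each letter of M occurring
-- in v) is determined by its pattern, the word of ranks 1 + rank x v ∈ [1, length v];
-- conversely a pattern φ over [1, length v] is instantiated back by j ↦ v_j.
patternOf : List ℕ → List ℕ → List ℕ
patternOf v M = map (λ x → suc (rank x v)) M

instantiate : List ℕ → List ℕ → List ℕ
instantiate v φ = map (λ j → nth v (j ∸ 1)) φ

module Compression {a : ℕ} (v : List ℕ) (v-asc : Ascending a v) where

  private
    s : ℕ
    s = length v

    InPositions : ℕ → Set
    InPositions j = inInterval 1 s j ≡ true

    InValues : ℕ → Set
    InValues x = mem x v ≡ true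

  patternOf-instantiate : ∀ φ → All InPositions φ → patternOf v (instantiate v φ) ≡ φ
  patternOf-instantiate φ φ∈ = trans (sym (ListP.map-∘ φ)) (ListP.map-id-local (All.map rank-value φ∈))
    where
    rank-value : ∀ {j} → InPositions j → suc (rank (nth v (j ∸ 1)) v) ≡ j
    rank-value {j} h = trans (cong suc (rank-nth v (j ∸ 1) v-asc (position-index j h))) (position-suc-pred j h)

  instantiate-patternOf : ∀ M → All InValues M → instantiate v (patternOf v M) ≡ M
  instantiate-patternOf M M∈ = trans (sym (ListP.map-∘ M)) (ListP.map-id-local (All.map (λ {x} → nth-rank x v v-asc) M∈))

  instantiate-letters : ∀ φ → All InPositions φ → All InValues (instantiate v φ)
  instantiate-letters φ φ∈ = AllP.map⁺ (All.map (λ {j} h → nth-mem v (j ∸ 1) (position-index j h)) φ∈)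

  patternOf-letters : ∀ M → All InValues M → All InPositions (patternOf v M)
  patternOf-letters M M∈ = AllP.map⁺ (All.map (λ {x} h → inInterval-true (s≤s z≤n) (s≤s (rank-lt x v h))) M∈)

  module Instantiate = StrictlyMonotone InPositions (λ j → nth v (j ∸ 1))
    (λ j j' h h' j<j' → nth-mono v (j ∸ 1) (j' ∸ 1) v-asc (∸-monoˡ-< j<j' (proj₁ (inInterval-sound 1 s j h))) (position-index j' h'))
  module PatternOf = StrictlyMonotone InValues (λ x → suc (rank x v))
    (λ x x' h _ x<x' → s≤s (rank-strict x x' v h x<x'))

  patternOf-surjective : ∀ M → All (λ x → mem x M ≡ true) v → surjOnto s (patternOf v M) ≡ true
  patternOf-surjective M v⊆M = all-intro _ (range1 s) (All.map (λ {t} → hit t) (elems-valid (rangeEnum s)))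
    where
    hit : ∀ t → InPositions t → mem t (patternOf v M) ≡ true
    hit t h = subst (λ z → mem z (patternOf v M) ≡ true) (trans (cong suc (rank-nth v (t ∸ 1) v-asc t-1<s)) (position-suc-pred t h))
      (mem-map (λ x → suc (rank x v)) {nth v (t ∸ 1)} M (mem-All {x = nth v (t ∸ 1)} v v⊆M (nth-mem v (t ∸ 1) t-1<s)))
      where
      t-1<s : t ∸ 1 < s
      t-1<s = position-index t h

  instantiate-covers : ∀ φ → surjOnto s φ ≡ true → ∀ x → InValues x → mem x (instantiate v φ) ≡ true
  instantiate-covers φ surj x h = subst (λ z → mem z (instantiate v φ) ≡ true) (nth-rank x v v-asc h)
    (mem-map (λ j → nth v (j ∸ 1)) {suc (rank x v)} φ (mem-All {x = suc (rank x v)} (range1 s) (all-sound _ (range1 s) surj)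
      (mem-range1 s (suc (rank x v)) (inInterval-true (s≤s z≤n) (s≤s (rank-lt x v h))))))

  mem-instantiate : ∀ φ → All InPositions φ → surjOnto s φ ≡ true → ∀ x → mem x (instantiate v φ) ≡ mem x v
  mem-instantiate φ φ∈ surj x = bool-ext _ _ to (instantiate-covers φ surj x)
    where
    to : mem x (instantiate v φ) ≡ true → InValues x
    to h with mem-map⁻ (λ j → nth v (j ∸ 1)) {x} φ h
    ... | j , j∈φ , vj≡x = subst InValues vj≡x (nth-mem v (j ∸ 1) (position-index j (mem-All {x = j} φ φ∈ j∈φ)))

valuesIn : ℕ → List ℕ → List ℕ
valuesIn n M = filterᵇ (λ x → mem x M) (range1 n)

valuesIn-ascending : ∀ n M → Ascending 0 (valuesIn n M)
valuesIn-ascending n M = Ascending-filter _ (range1 n) (subst (Ascending 0) (sym (range1≡fromTo n)) (Ascending-fromTo n 1 0 (s≤s z≤n)))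

valuesIn-range : ∀ n M → All (λ x → inInterval 1 n x ≡ true) (valuesIn n M)
valuesIn-range n M = AllP.filter⁺ (T? ∘ (λ x → mem x M)) (elems-valid (rangeEnum n))

valuesIn-⊆ : ∀ n M → All (λ x → mem x M ≡ true) (valuesIn n M)
valuesIn-⊆ n M = All-filterᵇ (λ x → mem x M) (range1 n)

valuesIn-⊇ : ∀ n M → All (λ x → inInterval 1 n x ≡ true) M → All (λ x → mem x (valuesIn n M) ≡ true) M
valuesIn-⊇ n M M∈ = All.zipWith (λ { {x} (h , x∈M) → mem-filter⁺ (λ y → mem y M) {x} (range1 n) (mem-range1 n x h) x∈M }) (M∈ , mem-self M)

valuesIn-instantiate : ∀ n v φ → Ascending 0 v → All (_< suc n) v → All (λ j → inInterval 1 (length v) j ≡ true) φ →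
  surjOnto (length v) φ ≡ true → valuesIn n (instantiate v φ) ≡ v
valuesIn-instantiate n v φ v-asc v<p φ∈ surj = begin
  filterᵇ (λ x → mem x (instantiate v φ)) (range1 n)
    ≡⟨ filter-congAll _ _ (range1 n) (All.universal (Compression.mem-instantiate v v-asc φ φ∈ surj) (range1 n)) ⟩
  filterᵇ (λ x → mem x v) (range1 n)
    ≡⟨ cong (filterᵇ (λ x → mem x v)) (range1≡fromTo n) ⟩
  filterᵇ (λ x → mem x v) (fromTo 1 n)
    ≡⟨ filter-fromTo-mem n 1 v v-asc (All.zipWith (λ bounds → bounds) (Ascending-All v v-asc , v<p)) ⟩
  v ∎
  where open ≡-Reasoning

-- Residue sequences start from the residue 0 of the empty sum, which adds no descent and,
-- before nonzero letters, no equal neighbours.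
descents-0∷ : ∀ xs → descents (0 ∷ xs) ≡ descents xs
descents-0∷ []      = refl
descents-0∷ (x ∷ _) = refl

adjDistinct-tail : ∀ x xs → adjDistinct (x ∷ xs) ≡ true → adjDistinct xs ≡ true
adjDistinct-tail x []       _ = refl
adjDistinct-tail x (y ∷ xs) e = ∧-true-r {not (x ≡ᵇ y)} e

adjDistinct-0∷ : ∀ xs → All (1 ≤_) xs → adjDistinct xs ≡ true → adjDistinct (0 ∷ xs) ≡ true
adjDistinct-0∷ []           _       _ = refl
adjDistinct-0∷ (suc x ∷ xs) _       e = e
adjDistinct-0∷ (zero ∷ xs)  (() ∷ _) _

covers-nonempty : ∀ {xs} ys → All (λ x → mem x ys ≡ true) xs → 1 ≤ length xs → 1 ≤ length ys
covers-nonempty []      (() ∷ _) _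
covers-nonempty (_ ∷ _) _        _ = s≤s z≤n

module Sides (n i : ℕ) (ks : List ℕ) (1≤r : 1 ≤ length ks) (1≤i : 1 ≤ i) where

  open Residues n using (p; IsStep; residues; gaps; length-gaps; residues-encode; residues-decode)

  r : ℕ
  r = length ks

  stepWords : Enumeration (List ℕ)
  stepWords = wordEnum r (rangeEnum n) (λ _ _ → refl)

  inBlock : List ℕ → Bool
  inBlock ls = ((i ∸ 1) * p <ᵇ sum ls) ∧ (sum ls <ᵇ i * p) ∧ all (λ L → not (modP p L ≡ᵇ 0)) (partialSums ls)

  admissible : List ℕ → Bool
  admissible M = adjDistinct M ∧ (descents M + 1 ≡ᵇ i)

  admissible-intro : ∀ M → adjDistinct M ≡ true → descents M ≡ i ∸ 1 → admissible M ≡ true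
  admissible-intro M adj desc rewrite adj | desc | +-comm (i ∸ 1) 1 | m+[n∸m]≡n 1≤i = ≡ᵇ-refl i

  admissible-descents : ∀ M → admissible M ≡ true → descents M ≡ i ∸ 1
  admissible-descents M e = trans (sym (m+n∸n≡m (descents M) 1))
    (cong (_∸ 1) (≡ᵇ-sound (descents M + 1) i (∧-true-r {adjDistinct M} e)))

  in-letters : ∀ {x} → inInterval 1 n x ≡ true → IsStep x
  in-letters {x} = inInterval-sound 1 n x

  nonzero-residue : ∀ L → not (L % p ≡ᵇ 0) ≡ true → inInterval 1 n (L % p) ≡ true
  nonzero-residue L h = inInterval-true (n≢0⇒n>0 (λ L%p≡0 → false≢true (subst (λ z → not (z ≡ᵇ 0) ≡ true) L%p≡0 h))) (m%n<n L p)

  letter-nonzero : ∀ x → inInterval 1 n x ≡ true → not (x ≡ᵇ 0) ≡ true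
  letter-nonzero zero    h = ⊥-elim (<⇒≱ (proj₁ (in-letters {0} h)) z≤n)
  letter-nonzero (suc x) h = refl

  steps→residues : ∀ ls → valid stepWords ls ≡ true → inBlock ls ≡ true →
    valid stepWords (residues 0 ls) ≡ true × admissible (residues 0 ls) ≡ true ×
    gaps 0 (residues 0 ls) ≡ ls × term p ks ls ≡ termOf p ks (residues 0 ls)
  steps→residues ls v e with validWord-sound r (inInterval 1 n) ls v
  ... | len , ls∈ with residues-encode ls 0 (All.map in-letters ls∈)
  ... | gaps≡ , adj , quot = residues-valid , admissible-intro (residues 0 ls) (adjDistinct-tail 0 (residues 0 ls) adj) desc , gaps≡ ,
                            sym (termOf-residues n ks (psums 0 ls))
    where
    lower = <ᵇ-sound _ _ (∧-true-l e)
    upper = <ᵇ-sound _ _ (∧-true-l (∧-true-r {(i ∸ 1) * p <ᵇ sum ls} e))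
    nonzero = all-sound _ (psums 0 ls) (∧-true-r {sum ls <ᵇ i * p} (∧-true-r {(i ∸ 1) * p <ᵇ sum ls} e))
    residues-valid : validWord r (inInterval 1 n) (residues 0 ls) ≡ true
    residues-valid = validWord-intro r _ _ (trans (ListP.length-map _ (psums 0 ls)) (trans (length-psums 0 ls) len))
      (AllP.map⁺ (All.map (λ {L} → nonzero-residue L) nonzero))
    desc : descents (residues 0 ls) ≡ i ∸ 1
    desc = trans (sym (descents-0∷ (residues 0 ls))) (trans (sym quot) (quotient-in-block n (sum ls) i 1≤i lower upper))

  residues→steps : ∀ M → valid stepWords M ≡ true → admissible M ≡ true →
    valid stepWords (gaps 0 M) ≡ true × inBlock (gaps 0 M) ≡ true × residues 0 (gaps 0 M) ≡ M
  residues→steps M v e with validWord-sound r (inInterval 1 n) M v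
  ... | len , M∈ with residues-decode M 0 (All.map (λ h → proj₂ (in-letters h)) M∈)
                        (adjDistinct-0∷ M (All.map (λ h → proj₁ (in-letters h)) M∈) (∧-true-l e))
  ... | steps , residues≡ = steps-valid , ∧-true (<ᵇ-true lower) (∧-true (<ᵇ-true upper) nonzero) , residues≡
    where
    ls = gaps 0 M
    len-ls : length ls ≡ r
    len-ls = trans (length-gaps 0 M) len
    steps-valid : validWord r (inInterval 1 n) ls ≡ true
    steps-valid = validWord-intro r _ ls len-ls (All.map (λ (1≤l , l<p) → inInterval-true 1≤l l<p) steps)
    residues∈ : All (λ x → inInterval 1 n x ≡ true) (residues 0 ls)
    residues∈ = subst (All (λ x → inInterval 1 n x ≡ true)) (sym residues≡) M∈
    quot : sum ls / p ≡ i ∸ 1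
    quot = begin
      sum ls / p                      ≡⟨ proj₂ (proj₂ (residues-encode ls 0 steps)) ⟩
      descents (0 ∷ residues 0 ls)    ≡⟨ cong (descents ∘ (0 ∷_)) residues≡ ⟩
      descents (0 ∷ M)                ≡⟨ descents-0∷ M ⟩
      descents M                      ≡⟨ admissible-descents M e ⟩
      i ∸ 1                           ∎
      where open ≡-Reasoning
    total-residue : 1 ≤ sum ls % p
    total-residue = proj₁ (in-letters (mem-All {x = sum ls % p} _ residues∈
      (mem-map (_% p) {sum ls} (psums 0 ls) (total-mem-psums 0 ls (subst (1 ≤_) (sym len-ls) 1≤r)))))
    lower = proj₁ (block-of-quotient n (sum ls) i 1≤i total-residue quot)
    upper = proj₂ (block-of-quotient n (sum ls) i 1≤i total-residue quot)
    nonzero : all (λ L → not (L % p ≡ᵇ 0)) (psums 0 ls) ≡ true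
    nonzero = all-intro _ (psums 0 ls) (AllP.map⁻ (All.map (λ {x} → letter-nonzero x) residues∈))

  lhs-as-residues : ∑ (elems stepWords) (λ ls → if inBlock ls then term p ks ls else 0)
                  ≡ ∑ (elems stepWords) (λ M → if admissible M then termOf p ks M else 0)
  lhs-as-residues = sum-bijection stepWords stepWords inBlock admissible (residues 0) (gaps 0)
                      (term p ks) (termOf p ks) steps→residues residues→steps

  -- triples (s, φ, ls): a number s ∈ [1, r] of distinct values, a word φ ∈ [1, s]^r and
  -- steps ls ∈ [1, p - 1]^s whose partial sums are the values
  triples : Enumeration (ℕ × List ℕ × List ℕ)
  triples = pairEnum (rangeEnum r) (λ s →
    pairEnum (wordEnum r (rangeEnum s) (λ _ _ → refl)) (λ _ → wordEnum s (rangeEnum n) (λ _ _ → refl)))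

  surjAdj : ℕ → List ℕ → Bool
  surjAdj s φ = surjOnto s φ ∧ adjDistinct φ

  hasDescents : ℕ × List ℕ → Bool
  hasDescents (s , φ) = (descents φ + 1) ≡ᵇ i

  inPhi : ℕ × List ℕ × List ℕ → Bool
  inPhi (s , φ , ls) = (surjAdj s φ ∧ hasDescents (s , φ)) ∧ (sum ls <ᵇ p)

  summand : ℕ × List ℕ × List ℕ → ℕ
  summand (s , φ , ls) = term p (merge ks s φ) ls

  compose : ℕ × List ℕ × List ℕ → List ℕ
  compose (s , φ , ls) = instantiate (psums 0 ls) φ

  decompose : List ℕ → ℕ × List ℕ × List ℕ
  decompose M = length (valuesIn n M) , patternOf (valuesIn n M) M , differences 0 (valuesIn n M)

  record TripleFacts (s : ℕ) (φ ls : List ℕ) : Set where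
    field
      length-φ  : length φ ≡ r
      φ∈        : All (λ j → inInterval 1 s j ≡ true) φ
      length-ls : length ls ≡ s
      ls∈       : All (λ l → inInterval 1 n l ≡ true) ls
      surj      : surjOnto s φ ≡ true
      adj       : adjDistinct φ ≡ true
      desc      : descents φ ≡ i ∸ 1
      total<p   : sum ls < p

  triple-facts : ∀ s φ ls → valid triples (s , φ , ls) ≡ true → inPhi (s , φ , ls) ≡ true → TripleFacts s φ ls
  triple-facts s φ ls vt pt = record
    { length-φ = proj₁ φ-valid ; φ∈ = proj₂ φ-valid ; length-ls = proj₁ ls-valid ; ls∈ = proj₂ ls-valid
    ; surj = ∧-true-l (∧-true-l (∧-true-l pt)) ; adj = adj
    ; desc = admissible-descents φ (∧-true adj (∧-true-r {surjOnto s φ ∧ adjDistinct φ} (∧-true-l pt)))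
    ; total<p = <ᵇ-sound (sum ls) p (∧-true-r {(surjOnto s φ ∧ adjDistinct φ) ∧ ((descents φ + 1) ≡ᵇ i)} pt) }
    where
    φ-valid = validWord-sound r (inInterval 1 s) φ (∧-true-l (∧-true-r {inInterval 1 r s} vt))
    ls-valid = validWord-sound s (inInterval 1 n) ls (∧-true-r {validWord r (inInterval 1 s) φ} (∧-true-r {inInterval 1 r s} vt))
    adj = ∧-true-r {surjOnto s φ} (∧-true-l (∧-true-l pt))

  triple→residues : ∀ t → valid triples t ≡ true → inPhi t ≡ true →
    valid stepWords (compose t) ≡ true × admissible (compose t) ≡ true × decompose (compose t) ≡ t ×
    summand t ≡ termOf p ks (compose t)
  triple→residues (s , φ , ls) vt pt = M-valid , M-admissible , decompose≡ , summand≡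
    where
    open TripleFacts (triple-facts s φ ls vt pt)
    v = psums 0 ls
    v-asc : Ascending 0 v
    v-asc = psums-ascending 0 ls (All.map (λ h → proj₁ (in-letters h)) ls∈)
    length-v : length v ≡ s
    length-v = trans (length-psums 0 ls) length-ls
    v<p : All (_< p) v
    v<p = All.map (λ h → ≤-<-trans h total<p) (psums-bounded 0 ls)
    φ∈' : All (λ j → inInterval 1 (length v) j ≡ true) φ
    φ∈' = subst (λ z → All (λ j → inInterval 1 z j ≡ true) φ) (sym length-v) φ∈
    open Compression v v-asc
    M = instantiate v φ
    M-valid : validWord r (inInterval 1 n) M ≡ true
    M-valid = validWord-intro r _ M (trans (ListP.length-map _ φ) length-φ)
      (All.map (λ {x} x∈v → inInterval-true (mem-All {x = x} v (Ascending-All v v-asc) x∈v) (mem-All {x = x} v v<p x∈v)) (instantiate-letters φ φ∈'))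
    M-admissible : admissible M ≡ true
    M-admissible = admissible-intro M (trans (Instantiate.adjDistinct-map φ φ∈') adj) (trans (Instantiate.descents-map φ φ∈') desc)
    values≡ : valuesIn n M ≡ v
    values≡ = valuesIn-instantiate n v φ v-asc v<p φ∈' (subst (λ z → surjOnto z φ ≡ true) (sym length-v) surj)
    decompose≡ : decompose M ≡ (s , φ , ls)
    decompose≡ rewrite values≡ = cong₂ _,_ length-v (cong₂ _,_ (patternOf-instantiate φ φ∈') (differences-psums 0 ls))
    summand≡ : summand (s , φ , ls) ≡ termOf p ks M
    summand≡ = merge-product (invP p) s v ks φ length-v (sym length-φ) φ∈

  residues→triple : ∀ M → valid stepWords M ≡ true → admissible M ≡ true →
    valid triples (decompose M) ≡ true × inPhi (decompose M) ≡ true × compose (decompose M) ≡ M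
  residues→triple M vM e = triple-valid , triple-inPhi , compose≡
    where
    M-facts = validWord-sound r (inInterval 1 n) M vM
    M∈ = proj₂ M-facts
    v = valuesIn n M
    s = length v
    v-asc = valuesIn-ascending n M
    open Compression v v-asc
    M⊆v : All (λ x → mem x v ≡ true) M
    M⊆v = valuesIn-⊇ n M M∈
    v<p : All (_< p) v
    v<p = All.map (λ h → proj₂ (in-letters h)) (valuesIn-range n M)
    φ = patternOf v M
    ls = differences 0 v
    1≤s : 1 ≤ s
    1≤s = covers-nonempty v M⊆v (subst (1 ≤_) (sym (proj₁ M-facts)) 1≤r)
    s≤r : s ≤ r
    s≤r = ≤-trans (ascending-length-≤ v M v-asc (valuesIn-⊆ n M)) (≤-reflexive (proj₁ M-facts))
    φ-valid : validWord r (inInterval 1 s) φ ≡ true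
    φ-valid = validWord-intro r _ φ (trans (ListP.length-map _ M) (proj₁ M-facts)) (patternOf-letters M M⊆v)
    ls-valid : validWord s (inInterval 1 n) ls ≡ true
    ls-valid = validWord-intro s _ ls (length-differences 0 v)
      (All.map (λ (1≤d , d<p) → inInterval-true 1≤d d<p) (differences-steps p 0 v v-asc v<p))
    triple-valid : valid triples (s , φ , ls) ≡ true
    triple-valid = ∧-true (inInterval-true 1≤s (s≤s s≤r)) (∧-true φ-valid ls-valid)
    triple-inPhi : inPhi (s , φ , ls) ≡ true
    triple-inPhi = ∧-true (∧-true (∧-true (patternOf-surjective M (valuesIn-⊆ n M)) (trans (PatternOf.adjDistinct-map M M⊆v) (∧-true-l e)))
                                  (subst (λ d → (d + 1 ≡ᵇ i) ≡ true) (sym (PatternOf.descents-map M M⊆v)) (∧-true-r {adjDistinct M} e)))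
                          (<ᵇ-true (differences-total p 0 v v-asc v<p (s≤s z≤n)))
    compose≡ : compose (s , φ , ls) ≡ M
    compose≡ rewrite psums-differences 0 v v-asc = instantiate-patternOf M M⊆v

  rhs-as-residues : ∑ (elems triples) (λ t → if inPhi t then summand t else 0)
                  ≡ ∑ (elems stepWords) (λ M → if admissible M then termOf p ks M else 0)
  rhs-as-residues = sum-bijection triples stepWords inPhi admissible compose decompose
                      summand (termOf p ks) triple→residues residues→triple

  zetaSum : List ℕ → ℕ
  zetaSum K = ∑ (filterᵇ (λ ls → sum ls <ᵇ p) (lists (length K) (range1 n))) (term p K)

  length-merge : ∀ s φ → length (merge ks s φ) ≡ s
  length-merge s φ = trans (ListP.length-map _ (range1 s)) (trans (cong length (range1≡fromTo s)) (length-fromTo s))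
    where
    length-fromTo : ∀ k {a} → length (fromTo a k) ≡ k
    length-fromTo zero    = refl
    length-fromTo (suc k) = cong suc (length-fromTo k)

  fixed-pattern-sum : ∀ s φ →
    ∑ (lists s (range1 n)) (λ ls → if inPhi (s , φ , ls) then summand (s , φ , ls) else 0)
    ≡ (if surjAdj s φ then (if hasDescents (s , φ) then zetaSum (merge ks s φ) else 0) else 0)
  fixed-pattern-sum s φ = begin
    ∑ (lists s R) (λ ls → if (surjAdj s φ ∧ D) ∧ (sum ls <ᵇ p) then summand (s , φ , ls) else 0)
      ≡⟨ ∑-cong (lists s R) (λ ls → if-∧ (surjAdj s φ ∧ D) (sum ls <ᵇ p) _) ⟩
    ∑ (lists s R) (λ ls → if surjAdj s φ ∧ D then (if sum ls <ᵇ p then summand (s , φ , ls) else 0) else 0)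
      ≡⟨ ∑-if (lists s R) (surjAdj s φ ∧ D) _ ⟩
    (if surjAdj s φ ∧ D then ∑ (lists s R) (λ ls → if sum ls <ᵇ p then summand (s , φ , ls) else 0) else 0)
      ≡⟨ if-∧ (surjAdj s φ) D _ ⟩
    (if surjAdj s φ then (if D then ∑ (lists s R) (λ ls → if sum ls <ᵇ p then summand (s , φ , ls) else 0) else 0) else 0)
      ≡⟨ cong (λ z → if surjAdj s φ then (if D then z else 0) else 0) truncated ⟩
    (if surjAdj s φ then (if D then zetaSum (merge ks s φ) else 0) else 0) ∎
    where
    open ≡-Reasoning
    R = range1 n
    D = hasDescents (s , φ)
    truncated : ∑ (lists s R) (λ ls → if sum ls <ᵇ p then summand (s , φ , ls) else 0) ≡ zetaSum (merge ks s φ)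
    truncated = begin
      ∑ (lists s R) (λ ls → if sum ls <ᵇ p then term p (merge ks s φ) ls else 0)
        ≡⟨ cong (λ l → ∑ (lists l R) (λ ls → if sum ls <ᵇ p then term p (merge ks s φ) ls else 0)) (sym (length-merge s φ)) ⟩
      ∑ (lists (length (merge ks s φ)) R) (λ ls → if sum ls <ᵇ p then term p (merge ks s φ) ls else 0)
        ≡⟨ ∑-filter (lists (length (merge ks s φ)) R) (λ ls → sum ls <ᵇ p) (term p (merge ks s φ)) ⟨
      zetaSum (merge ks s φ) ∎

  rhs-as-triples : ∑ (PhiI r i) (λ sφ → zetaSum (merge ks (proj₁ sφ) (proj₂ sφ)))
                 ≡ ∑ (elems triples) (λ t → if inPhi t then summand t else 0)
  rhs-as-triples = begin
    ∑ (PhiI r i) Z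
      ≡⟨ ∑-filter (concatMap (λ s → map (s ,_) (Phi r s)) (range1 r)) hasDescents Z ⟩
    ∑ (concatMap (λ s → map (s ,_) (Phi r s)) (range1 r)) (λ sφ → if hasDescents sφ then Z sφ else 0)
      ≡⟨ ∑-concatMap (range1 r) _ _ ⟩
    ∑ (range1 r) (λ s → ∑ (map (s ,_) (Phi r s)) (λ sφ → if hasDescents sφ then Z sφ else 0))
      ≡⟨ ∑-cong (range1 r) (λ s → trans (∑-map (Phi r s) (s ,_) _) (∑-filter (lists r (range1 s)) (surjAdj s) _)) ⟩
    ∑ (range1 r) (λ s → ∑ (lists r (range1 s)) (λ φ → if surjAdj s φ then (if hasDescents (s , φ) then Z (s , φ) else 0) else 0))
      ≡⟨ ∑-cong (range1 r) (λ s → ∑-cong (lists r (range1 s)) (λ φ → fixed-pattern-sum s φ)) ⟨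
    ∑ (range1 r) (λ s → ∑ (lists r (range1 s)) (λ φ → ∑ (lists s (range1 n)) (λ ls → F (s , φ , ls))))
      ≡⟨ ∑-cong (range1 r) (λ s → flatten s (range1 s) (lists s (range1 n))) ⟩
    ∑ (range1 r) (λ s → ∑ (map (s ,_) (concatMap (λ φ → map (φ ,_) (lists s (range1 n))) (lists r (range1 s)))) F)
      ≡⟨ ∑-concatMap (range1 r) _ F ⟨
    ∑ (elems triples) F ∎
    where
    open ≡-Reasoning
    Z : ℕ × List ℕ → ℕ
    Z sφ = zetaSum (merge ks (proj₁ sφ) (proj₂ sφ))
    F : ℕ × List ℕ × List ℕ → ℕ
    F t = if inPhi t then summand t else 0
    flatten : ∀ s (R : List ℕ) (Ls : List (List ℕ)) →
      ∑ (lists r R) (λ φ → ∑ Ls (λ ls → F (s , φ , ls))) ≡ ∑ (map (s ,_) (concatMap (λ φ → map (φ ,_) Ls) (lists r R))) F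
    flatten s R Ls = sym (begin
      ∑ (map (s ,_) (concatMap (λ φ → map (φ ,_) Ls) (lists r R))) F
        ≡⟨ ∑-map (concatMap (λ φ → map (φ ,_) Ls) (lists r R)) (s ,_) F ⟩
      ∑ (concatMap (λ φ → map (φ ,_) Ls) (lists r R)) (λ b → F (s , b))
        ≡⟨ ∑-concatMap (lists r R) (λ φ → map (φ ,_) Ls) (λ b → F (s , b)) ⟩
      ∑ (lists r R) (λ φ → ∑ (map (φ ,_) Ls) (λ b → F (s , b)))
        ≡⟨ ∑-cong (lists r R) (λ φ → ∑-map Ls (φ ,_) (λ b → F (s , b))) ⟩
      ∑ (lists r R) (λ φ → ∑ Ls (λ ls → F (s , φ , ls))) ∎)

components-agree : ∀ n i ks → 1 ≤ length ks → 1 ≤ i → zetaAi (suc n) i ks ≡ rhsP (suc n) i ks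
components-agree n i ks 1≤r 1≤i = begin
  zetaAi p i ks
    ≡⟨ cong (_% p) (∑-filter (elems stepWords) inBlock (term p ks)) ⟩
  ∑ (elems stepWords) (λ ls → if inBlock ls then term p ks ls else 0) % p
    ≡⟨ cong (_% p) (trans lhs-as-residues (sym rhs-as-residues)) ⟩
  ∑ (elems triples) (λ t → if inPhi t then summand t else 0) % p
    ≡⟨ cong (_% p) rhs-as-triples ⟨
  ∑ (PhiI r i) (λ sφ → zetaSum (merge ks (proj₁ sφ) (proj₂ sφ))) % p
    ≡⟨ ∑-mod n (PhiI r i) _ ⟨
  rhsP p i ks ∎
  where
  open ≡-Reasoning
  open Sides n i ks 1≤r 1≤i
  p = suc n

-- Proposition 2.4.  The p-components agree for every p ≥ 2, in particular for all primes.
proposition2p4 : (r : ℕ) → 1 ≤ r → (ks : List ℕ) → length ks ≡ r → All (1 ≤_) ks →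
    (i : ℕ) → 1 ≤ i → i ≤ r →
    ∃[ N ] ((p : ℕ) → Prime p → N < p → zetaAi p i ks ≡ rhsP p i ks)
proposition2p4 r 1≤r ks length≡r _ i 1≤i _ = 1 , agree
  where
  agree : (p : ℕ) → Prime p → 1 < p → zetaAi p i ks ≡ rhsP p i ks
  agree (suc n) _ _ = components-agree n i ks (subst (1 ≤_) (sym length≡r) 1≤r) 1≤i
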